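{- Let $G$ be a subcubic graph, $\pi=\{V_1,\dots,V_k\}$ a connected coalition partition of $G$, and $H=CCG(G,\pi)$. If $k=5$, then $H$ is isomorphic to one of the graphs $P_2\cup P_3$, $S_{1,2}$, $S_5$, $P_5$, $C_3+e+e$, $C_3+2e$, $C_4+e$, $C_5$, $K_{2,3}$.
   Context: Graphs are finite and simple. A graph is subcubic if it is connected and its maximum vertex degree is at most 3. $G[S]$ is the induced subgraph. A set $D\subseteq V$ is dominating if every vertex of $V\setminus D$ has a neighbour in $D$; connected dominating if moreover $G[D]$ is connected. Two disjoint subsets $A,B\subseteq V$ form a connected coalition if neither is a connected dominating set but $A\cup B$ is. A connected coalition partition of $G$ is a partition $\pi=\{V_1,\dots,V_k\}$ of $V$ such that each $V_i$ either is a connected dominating set consisting of a single vertex or forms a connected coalition with some set of $\pi$. The coalition graph $CCG(G,\pi)$ has vertex set $\{V_1,\dots,V_k\}$, with $V_i\sim V_j$ iff they form a connected coalition. Notation: $P_2\cup P_3$ is a disjoint union; $S_5=K_{1,4}$; $S_{1,2}$ is the unique 5-vertex tree other than $P_5$ and $S_5$ (a vertex of degree 3 one of whose neighbours has one further pendant neighbour); $C_3+2e$ is a triangle with two pendant vertices attached to the same triangle vertex; $C_3+e+e$ is a triangle with two pendant vertices attached to two different triangle vertices; $C_4+e$ is a 4-cycle with one pendant vertex attached. -}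

module Defs where

open import Data.Nat using (ℕ; zero; suc; _≤_)
open import Data.Bool using (Bool; true; false; if_then_else_; T)
open import Data.Fin using (Fin; zero; suc; _≟_)
open import Data.List using (List; []; _∷_; allFin; map)
open import Data.Nat.ListAction using (sum)
open import Data.Bool.ListAction using (any)
open import Data.Product using (Σ; ∃; _×_; _,_)
open import Data.Sum using (_⊎_)
open import Relation.Nullary using (¬_)
open import Relation.Nullary.Decidable using (⌊_⌋)
open import Relation.Binary.PropositionalEquality using (_≡_; _≢_)
open import Data.Bool using (_∧_; _∨_)
open import Data.Fin.Permutation using (Permutation′; _⟨$⟩ʳ_)
open import Function.Bundles using (_⇔_)

record Graph : Set where
  field
    n     : ℕ
    adj   : Fin n → Fin n → Bool
    sym   : ∀ u v → adj u v ≡ adj v u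
    irref : ∀ v → adj v v ≡ false
open Graph public

VSet : Graph → Set₁
VSet G = Fin (n G) → Set

_∪_ : {G : Graph} → VSet G → VSet G → VSet G
(A ∪ B) v = A v ⊎ B v

Disjoint : {G : Graph} → VSet G → VSet G → Set
Disjoint {G} A B = ∀ (v : Fin (n G)) → A v → B v → Data.Empty.⊥
  where import Data.Empty

data WalkIn (G : Graph) (S : VSet G) : Fin (n G) → Fin (n G) → Set where
  here : ∀ {u} → S u → WalkIn G S u u
  step : ∀ {u v w} → S u → T (adj G u v) → WalkIn G S v w → WalkIn G S u w

InducedConnected : (G : Graph) → VSet G → Set
InducedConnected G S = ∀ u v → S u → S v → WalkIn G S u v

GraphConnected : Graph → Set
GraphConnected G = InducedConnected G (λ _ → Data.Unit.⊤)
  where import Data.Unit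

degree : (G : Graph) → Fin (n G) → ℕ
degree G v = sum (map (λ u → if adj G v u then 1 else 0) (allFin (n G)))

Subcubic : Graph → Set
Subcubic G = GraphConnected G × (∀ v → degree G v ≤ 3)

Dominating : (G : Graph) → VSet G → Set
Dominating G D = ∀ v → ¬ D v → ∃ λ u → D u × T (adj G u v)

ConnDominating : (G : Graph) → VSet G → Set
ConnDominating G D = Dominating G D × InducedConnected G D

ConnCoalition : (G : Graph) → VSet G → VSet G → Set
ConnCoalition G A B =
  Disjoint {G} A B × ¬ ConnDominating G A × ¬ ConnDominating G B
  × ConnDominating G (_∪_ {G} A B)

Class : (G : Graph) {k : ℕ} → (Fin (n G) → Fin k) → Fin k → VSet G
Class G part i v = part v ≡ i

IsCCPartition : (G : Graph) {k : ℕ} → (Fin (n G) → Fin k) → Set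
IsCCPartition G {k} part =
  (∀ i → ∃ λ v → part v ≡ i) ×
  (∀ i → (ConnDominating G (Class G part i) × (∃ λ v → ∀ u → part u ≡ i → u ≡ v))
         ⊎ (∃ λ j → ConnCoalition G (Class G part i) (Class G part j)))

CCGAdj : (G : Graph) {k : ℕ} → (Fin (n G) → Fin k) → Fin k → Fin k → Set
CCGAdj G part i j = ConnCoalition G (Class G part i) (Class G part j)

fromEdges : List (Fin 5 × Fin 5) → Fin 5 → Fin 5 → Bool
fromEdges es u v =
  any (λ { (a , b) → (⌊ a ≟ u ⌋ ∧ ⌊ b ≟ v ⌋) ∨ (⌊ a ≟ v ⌋ ∧ ⌊ b ≟ u ⌋) }) es

v0 v1 v2 v3 v4 : Fin 5
v0 = zero
v1 = suc zero
v2 = suc (suc zero)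
v3 = suc (suc (suc zero))
v4 = suc (suc (suc (suc zero)))

P2∪P3 S12 S5 P5 C3+e+e C3+2e C4+e C5 K23 : Fin 5 → Fin 5 → Bool
P2∪P3  = fromEdges ((v0 , v1) ∷ (v2 , v3) ∷ (v3 , v4) ∷ [])
S12    = fromEdges ((v0 , v1) ∷ (v0 , v2) ∷ (v0 , v3) ∷ (v3 , v4) ∷ [])
S5     = fromEdges ((v0 , v1) ∷ (v0 , v2) ∷ (v0 , v3) ∷ (v0 , v4) ∷ [])
P5     = fromEdges ((v0 , v1) ∷ (v1 , v2) ∷ (v2 , v3) ∷ (v3 , v4) ∷ [])
C3+e+e = fromEdges ((v0 , v1) ∷ (v1 , v2) ∷ (v2 , v0) ∷ (v0 , v3) ∷ (v1 , v4) ∷ [])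
C3+2e  = fromEdges ((v0 , v1) ∷ (v1 , v2) ∷ (v2 , v0) ∷ (v0 , v3) ∷ (v0 , v4) ∷ [])
C4+e   = fromEdges ((v0 , v1) ∷ (v1 , v2) ∷ (v2 , v3) ∷ (v3 , v0) ∷ (v0 , v4) ∷ [])
C5     = fromEdges ((v0 , v1) ∷ (v1 , v2) ∷ (v2 , v3) ∷ (v3 , v4) ∷ (v4 , v0) ∷ [])
K23    = fromEdges ((v0 , v2) ∷ (v0 , v3) ∷ (v0 , v4) ∷ (v1 , v2) ∷ (v1 , v3) ∷ (v1 , v4) ∷ [])

IsoTo : (Fin 5 → Fin 5 → Set) → (Fin 5 → Fin 5 → Bool) → Set
IsoTo E H = Σ (Permutation′ 5) λ σ → ∀ i j → E i j ⇔ T (H (σ ⟨$⟩ʳ i) (σ ⟨$⟩ʳ j))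

-- Since G has maximum degree 3 and the five classes are nonempty, no class is a singleton
-- connected dominating set, so H = CCG(G, π) has no isolated vertex. Two configurations
-- cannot occur in H.
--   * A class A forming coalitions with all four other classes while B also forms
--     coalitions with C and D: then every vertex has a neighbour in A, so every B-vertex
--     has at most two neighbours outside A, and C and D each induce a matching. Counting
--     edges of the connected graphs G[B ∪ C] and G[B ∪ D] against this budget leaves no
--     edge between B and the fifth class E, which makes every E-vertex a leaf of G[A ∪ E];
--     hence A itself is a connected dominating set.
--   * A triangle P, Q, R together with a disjoint edge D–E: every vertex has neighbours in
--     two of P, Q, R, hence at most one neighbour in S = D ∪ E, so S is a single edge d₀e₀
--     and d₀, e₀ each have exactly two further neighbours, in different classes. Some class
--     K then consists of one neighbour of d₀ and one of e₀, and the other two classes are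
--     single vertices l, m. The two K-vertices are not adjacent, as K would otherwise be a
--     connected dominating set, so the connected unions K ∪ {l} and {l, m} give l four
--     neighbours: both K-vertices, m, and a vertex of S.
-- An exhaustive search shows that every graph on five vertices without isolated vertices
-- that avoids both configurations is isomorphic to one of the nine listed graphs.
module Submission where

open import Data.Bool using (Bool; true; false; T; not; _∧_; _∨_; if_then_else_)
open import Data.Bool.Properties using (T-∧; T-∨; T-≡; ∧-identityʳ) renaming (_≟_ to _≟ᵇ_)
open import Data.Empty using (⊥; ⊥-elim)
open import Data.Fin using (Fin; zero; suc; toℕ; _≟_)
open import Data.Fin.Patterns using (0F; 1F; 2F; 3F; 4F)
open import Data.Fin.Permutation using (Permutation′; _⟨$⟩ʳ_; _⟨$⟩ˡ_; inverseˡ; inverseʳ)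
import Data.Fin.Permutation as Perm
open import Data.Fin.Properties using (all?; any?; injective⇒≤)
open import Data.List using (List; []; _∷_; length; allFin; map; concatMap; tabulate)
open import Data.List.Properties using (map-tabulate)
open import Data.List.Relation.Unary.All as All using (All; []; _∷_)
open import Data.List.Relation.Unary.Any as Any using (Any; here; there)
open import Data.List.Relation.Unary.Unique.Propositional using (Unique; []; _∷_)
import Data.Nat.ListAction as List
open import Data.Nat using (ℕ; zero; suc; _+_; _*_; _≤_; _<_; z≤n; s≤s; _≡ᵇ_)
open import Data.Nat.Properties hiding (_≟_)
open import Data.Nat.Properties using () renaming (_≟_ to _≟ℕ_)
open import Data.Nat.Solver using (module +-*-Solver)
open import Algebra.Properties.CommutativeSemigroup *-commutativeSemigroup using (x∙yz≈y∙xz)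
open import Algebra.Properties.Semiring.Sum +-*-semiring
  using (sum; sum-syntax; sum-cong-≗; ∑-distrib-+; ∑-comm; *-distribˡ-sum; sum-replicate-zero)
open import Data.Product using (∃; ∃₂; _×_; _,_; proj₁; proj₂)
open import Data.Sum using (_⊎_; inj₁; inj₂; [_,_])
import Data.Sum as Sum
open import Data.Unit using (⊤; tt)
open import Data.Vec using (Vec; []; _∷_)
import Data.Vec as Vec
open import Data.Vec.Properties using (lookup∘tabulate)
open import Function using (_∘_; id; Equivalence)
open import Function.Bundles using (mk⇔)
open import Relation.Nullary using (¬_; Dec; yes; no; does)
open import Relation.Nullary.Decidable
  using (T?; ⌊_⌋; _×-dec_; _⊎-dec_; _→-dec_; ¬?; map′; toWitness; fromWitness; decidable-stable; from-yes)
open import Relation.Binary.PropositionalEquality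
  using (_≡_; _≢_; refl; sym; trans; cong; cong₂; subst; subst₂; _≗_; module ≡-Reasoning)
open import Defs hiding (sym)

open Equivalence using (to; from)

𝟙 : Bool → ℕ
𝟙 b = if b then 1 else 0

χ : ∀ {n} → (Fin n → Bool) → Fin n → ℕ
χ X = 𝟙 ∘ X

count : ∀ {n} → (Fin n → Bool) → ℕ
count X = sum (χ X)

infixl 6 _⊕_
_⊕_ : ∀ {n} → (Fin n → ℕ) → (Fin n → ℕ) → Fin n → ℕ
(x ⊕ y) i = x i + y i

infixl 6 _∪ᵇ_
_∪ᵇ_ : ∀ {n} → (Fin n → Bool) → (Fin n → Bool) → Fin n → Bool
(X ∪ᵇ Y) i = X i ∨ Y i

-- `does` rather than `⌊_⌋`, so that ⁅ suc x ⁆ (suc i) reduces to ⁅ x ⁆ i.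
⁅_⁆ : ∀ {n} → Fin n → Fin n → Bool
⁅ x ⁆ i = does (x ≟ i)

_∖_ : ∀ {n} → (Fin n → Bool) → Fin n → Fin n → Bool
(X ∖ x) i = X i ∧ not (⁅ x ⁆ i)

T-ext : ∀ {a b} → (T a → T b) → (T b → T a) → a ≡ b
T-ext {false} {false} _   _   = refl
T-ext {false} {true}  _   b⇒a = ⊥-elim (b⇒a _)
T-ext {true}  {false} a⇒b _   = ⊥-elim (a⇒b _)
T-ext {true}  {true}  _   _   = refl

𝟙-mono : ∀ {a b} → (T a → T b) → 𝟙 a ≤ 𝟙 b
𝟙-mono {false}         _   = z≤n
𝟙-mono {true}  {true}  _   = ≤-refl
𝟙-mono {true}  {false} a⇒b = ⊥-elim (a⇒b _)

χ-∈ : ∀ {n} {X : Fin n → Bool} {x} → T (X x) → χ X x ≡ 1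
χ-∈ Xx = cong 𝟙 (to T-≡ Xx)

χ-∪ : ∀ {n} (X Y : Fin n → Bool) → (∀ i → ¬ (T (X i) × T (Y i))) → χ (X ∪ᵇ Y) ≗ χ X ⊕ χ Y
χ-∪ X Y disjoint i with X i | Y i | disjoint i
... | true  | true  | apart = ⊥-elim (apart (_ , _))
... | true  | false | _     = refl
... | false | _     | _     = refl

⁅⁆-refl : ∀ {n} (x : Fin n) → T (⁅ x ⁆ x)
⁅⁆-refl x with x ≟ x
... | yes _  = _
... | no x≢x = x≢x refl

⁅⁆-sound : ∀ {n} {x y : Fin n} → T (⁅ x ⁆ y) → x ≡ y
⁅⁆-sound {x = x} {y} hit with x ≟ y
... | yes x≡y = x≡y

∖-sound : ∀ {n} {X : Fin n → Bool} {x u} → T ((X ∖ x) u) → x ≢ u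
∖-sound {X = X} {x} {u} u∈ with x ≟ u
... | yes _   = ⊥-elim (proj₂ (to (T-∧ {X u}) u∈))
... | no x≢u = x≢u

sum-tabulate : ∀ {n} (f : Fin n → ℕ) → List.sum (tabulate f) ≡ sum f
sum-tabulate {zero}  f = refl
sum-tabulate {suc n} f = cong (f zero +_) (sum-tabulate (f ∘ suc))

∑-mono-≤ : ∀ {n} {f g : Fin n → ℕ} → (∀ i → f i ≤ g i) → sum f ≤ sum g
∑-mono-≤ {zero}  _   = z≤n
∑-mono-≤ {suc n} f≤g = +-mono-≤ (f≤g zero) (∑-mono-≤ (f≤g ∘ suc))

term≤∑ : ∀ {n} (f : Fin n → ℕ) i → f i ≤ sum f
term≤∑ f zero    = m≤m+n _ _
term≤∑ f (suc i) = ≤-trans (term≤∑ (f ∘ suc) i) (m≤n+m _ _)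

∑-sift : ∀ {n} (x : Fin n) (f : Fin n → ℕ) → sum (λ i → χ ⁅ x ⁆ i * f i) ≡ f x
∑-sift {suc n} zero f = begin
  1 * f zero + sum {n} (λ _ → 0) ≡⟨ cong₂ _+_ (*-identityˡ (f zero)) (sum-replicate-zero n) ⟩
  f zero + 0                     ≡⟨ +-identityʳ (f zero) ⟩
  f zero                         ∎
  where open ≡-Reasoning
∑-sift {suc n} (suc x) f = ∑-sift x (f ∘ suc)

∑-*ˡ : ∀ {n} k (f : Fin n → ℕ) → sum (λ i → k * f i) ≡ k * sum f
∑-*ˡ k f = sym (*-distribˡ-sum k f)

count-all : ∀ n → count {n} (λ _ → true) ≡ n
count-all zero    = refl
count-all (suc n) = cong suc (count-all n)

count-mono : ∀ {n} {X Y : Fin n → Bool} → (∀ i → T (X i) → T (Y i)) → count X ≤ count Y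
count-mono X⊆Y = ∑-mono-≤ (λ i → 𝟙-mono (X⊆Y i))

count-none : ∀ {n} {X : Fin n → Bool} → (∀ i → ¬ T (X i)) → count X ≡ 0
count-none {n} none =
  trans (sum-cong-≗ (λ i → cong 𝟙 (T-ext (⊥-elim ∘ none i) λ ()))) (sum-replicate-zero n)

count-∪ : ∀ {n} (X Y : Fin n → Bool) → (∀ i → ¬ (T (X i) × T (Y i))) → count (X ∪ᵇ Y) ≡ count X + count Y
count-∪ X Y disjoint = trans (sum-cong-≗ (χ-∪ X Y disjoint)) (∑-distrib-+ (χ X) (χ Y))

count-⁅⁆ : ∀ {n} (x : Fin n) → count ⁅ x ⁆ ≡ 1
count-⁅⁆ x = trans (sum-cong-≗ (λ i → sym (*-identityʳ (χ ⁅ x ⁆ i)))) (∑-sift x (λ _ → 1))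

count-remove : ∀ {n} (X : Fin n → Bool) {x} → T (X x) → count X ≡ suc (count (X ∖ x))
count-remove X {x} Xx = begin
  count X                      ≡⟨ sum-cong-≗ (cong 𝟙 ∘ split) ⟩
  count (⁅ x ⁆ ∪ᵇ (X ∖ x))     ≡⟨ count-∪ ⁅ x ⁆ (X ∖ x) disjoint ⟩
  count ⁅ x ⁆ + count (X ∖ x)  ≡⟨ cong (_+ count (X ∖ x)) (count-⁅⁆ x) ⟩
  suc (count (X ∖ x))          ∎
  where
  open ≡-Reasoning
  split : ∀ i → X i ≡ (⁅ x ⁆ ∪ᵇ (X ∖ x)) i
  split i with x ≟ i
  ... | yes refl = to T-≡ Xx
  ... | no  _    = sym (∧-identityʳ (X i))
  disjoint : ∀ i → ¬ (T (⁅ x ⁆ i) × T ((X ∖ x) i))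
  disjoint i (x≡i , i∈) = ∖-sound {X = X} {x} {i} i∈ (⁅⁆-sound x≡i)

count≤1 : ∀ {n} {X : Fin n → Bool} → (∀ {x y} → T (X x) → T (X y) → x ≡ y) → count X ≤ 1
count≤1 {X = X} unique with any? (λ x → T? (X x))
... | no  none     = ≤-trans (≤-reflexive (count-none (λ i Xi → none (i , Xi)))) z≤n
... | yes (x , Xx) = begin
  count X             ≡⟨ count-remove X Xx ⟩
  suc (count (X ∖ x)) ≡⟨ cong suc (count-none λ i i∈ → ∖-sound {X = X} {x} {i} i∈ (unique Xx (proj₁ (to T-∧ i∈)))) ⟩
  1                   ∎
  where open ≤-Reasoning

length≤count : ∀ {n} {X : Fin n → Bool} (xs : List (Fin n)) → Unique xs → All (T ∘ X) xs → length xs ≤ count X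
length≤count []       _               _          = z≤n
length≤count {X = X} (x ∷ xs) (x∉xs ∷ unique) (Xx ∷ Xxs) = begin
  suc (length xs)     ≤⟨ s≤s (length≤count xs unique (All.zipWith in-rest (x∉xs , Xxs))) ⟩
  suc (count (X ∖ x)) ≡⟨ count-remove X Xx ⟨
  count X             ∎
  where
  open ≤-Reasoning
  in-rest : ∀ {y} → x ≢ y × T (X y) → T ((X ∖ x) y)
  in-rest {y} (x≢y , Xy) with x ≟ y
  ... | yes x≡y = ⊥-elim (x≢y x≡y)
  ... | no  _   = from T-∧ (Xy , _)

module GraphLemmas (G : Graph) where

  V : Set
  V = Fin (n G)

  infix 4 _~_
  _~_ : V → V → Set
  u ~ v = T (adj G u v)

  ~-sym : ∀ {u v} → u ~ v → v ~ u
  ~-sym {u} {v} = subst T (Graph.sym G u v)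

  ~-irrefl : ∀ {u v} → u ~ v → u ≢ v
  ~-irrefl {u} u~u refl = subst T (irref G u) u~u

  walk-start : ∀ {P u v} → WalkIn G P u v → P u
  walk-start (here Pu)     = Pu
  walk-start (step Pu _ _) = Pu

  walk-map : ∀ {P Q : VSet G} → (∀ {u} → P u → Q u) → ∀ {u v} → WalkIn G P u v → WalkIn G Q u v
  walk-map P⊆Q (here Pu)          = here (P⊆Q Pu)
  walk-map P⊆Q (step Pu u~v walk) = step (P⊆Q Pu) u~v (walk-map P⊆Q walk)

  walk-snoc : ∀ {P u v w} → WalkIn G P u v → P w → v ~ w → WalkIn G P u w
  walk-snoc (here Pu)          Pw u~w = step Pu u~w (here Pw)
  walk-snoc (step Pu u~v walk) Pw v~w = step Pu u~v (walk-snoc walk Pw v~w)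

  walk-reverse : ∀ {P u v} → WalkIn G P u v → WalkIn G P v u
  walk-reverse (here Pu)          = here Pu
  walk-reverse (step Pu u~v walk) = walk-snoc (walk-reverse walk) Pu (~-sym u~v)

  walk-++ : ∀ {P u v w} → WalkIn G P u v → WalkIn G P v w → WalkIn G P u w
  walk-++ (here _)           rest = rest
  walk-++ (step Pu u~v walk) rest = step Pu u~v (walk-++ walk rest)

  walk-exit : ∀ {P} (R : V → Bool) {u w} → WalkIn G P u w → T (R u) → ¬ T (R w) →
              ∃₂ λ x y → T (R x) × ¬ T (R y) × P y × x ~ y
  walk-exit R (here _) Ru ¬Rw = ⊥-elim (¬Rw Ru)
  walk-exit R {u} (step {v = v} _ u~v walk) Ru ¬Rw with T? (R v)
  ... | yes Rv = walk-exit R walk Rv ¬Rw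
  ... | no ¬Rv = u , v , Ru , ¬Rv , walk-start walk , u~v

  module _ {A E : VSet G} (disjoint : ∀ {v} → A v → E v → ⊥)
           (pendant : ∀ {z w w′} → E z → (_∪_ {G} A E) w → (_∪_ {G} A E) w′ → z ~ w → z ~ w′ → w ≡ w′)
           where

    walk-prune : ∀ {x y} → WalkIn G (_∪_ {G} A E) x y → A x → A y → WalkIn G A x y
    walk-prune (here _)                                   Ax Ay = here Ax
    walk-prune (step _ x~z rest@(here (inj₁ Az)))         Ax Ay = step Ax x~z (walk-prune rest Az Ay)
    walk-prune (step _ x~z rest@(step (inj₁ Az) _ _))     Ax Ay = step Ax x~z (walk-prune rest Az Ay)
    walk-prune (step _ x~z (here (inj₂ Ez)))              Ax Ay = ⊥-elim (disjoint Ay Ez)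
    walk-prune (step AEx x~z (step (inj₂ Ez) z~z′ rest)) Ax Ay
      with pendant Ez (walk-start rest) AEx z~z′ (~-sym x~z)
    ... | refl = walk-prune rest Ax Ay

  connected-resp : ∀ {P Q : VSet G} → (∀ {u} → P u → Q u) → (∀ {u} → Q u → P u) →
                   InducedConnected G P → InducedConnected G Q
  connected-resp P⊆Q Q⊆P connected u v Qu Qv = walk-map P⊆Q (connected u v (Q⊆P Qu) (Q⊆P Qv))

  connDominating-resp : ∀ {P Q : VSet G} → (∀ {u} → P u → Q u) → (∀ {u} → Q u → P u) →
                        ConnDominating G P → ConnDominating G Q
  connDominating-resp P⊆Q Q⊆P (dominating , connected) =
    (λ v ¬Qv → let (u , Pu , u~v) = dominating v (¬Qv ∘ P⊆Q) in u , P⊆Q Pu , u~v) ,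
    connected-resp P⊆Q Q⊆P connected

  coalition-resp : ∀ {A A′ B B′ : VSet G} → (∀ {u} → A u → A′ u) → (∀ {u} → A′ u → A u) →
                   (∀ {u} → B u → B′ u) → (∀ {u} → B′ u → B u) →
                   ConnCoalition G A B → ConnCoalition G A′ B′
  coalition-resp A⇒A′ A′⇒A B⇒B′ B′⇒B (disjoint , ¬cdA , ¬cdB , cd) =
    (λ v A′v B′v → disjoint v (A′⇒A A′v) (B′⇒B B′v)) ,
    ¬cdA ∘ connDominating-resp A′⇒A A⇒A′ ,
    ¬cdB ∘ connDominating-resp B′⇒B B⇒B′ ,
    connDominating-resp (Sum.map A⇒A′ B⇒B′) (Sum.map A′⇒A B′⇒B) cd

  coalition-sym : ∀ {A B : VSet G} → ConnCoalition G A B → ConnCoalition G B A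
  coalition-sym (disjoint , ¬cdA , ¬cdB , cd) =
    (λ v Bv Av → disjoint v Av Bv) , ¬cdB , ¬cdA , connDominating-resp Sum.swap Sum.swap cd

  coalition-¬CDˡ : ∀ {A B : VSet G} → ConnCoalition G A B → ¬ ConnDominating G A
  coalition-¬CDˡ (_ , ¬cdA , _) = ¬cdA

  coalition-¬CDʳ : ∀ {A B : VSet G} → ConnCoalition G A B → ¬ ConnDominating G B
  coalition-¬CDʳ (_ , _ , ¬cdB , _) = ¬cdB

  coalition-CD : ∀ {A B : VSet G} → ConnCoalition G A B → ConnDominating G (_∪_ {G} A B)
  coalition-CD (_ , _ , _ , cd) = cd

  degree≡count : ∀ v → degree G v ≡ count (adj G v)
  degree≡count v = trans (cong List.sum (map-tabulate id (𝟙 ∘ adj G v))) (sum-tabulate (𝟙 ∘ adj G v))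

  n≤suc-degree : ∀ {v} → (∀ u → v ≢ u → v ~ u) → n G ≤ suc (degree G v)
  n≤suc-degree {v} adjacent-to-all = begin
    n G                              ≡⟨ count-all (n G) ⟨
    count {n G} (λ _ → true)         ≡⟨ count-remove (λ _ → true) {v} _ ⟩
    suc (count ((λ _ → true) ∖ v))   ≤⟨ s≤s (count-mono (λ u u∈ → adjacent-to-all u (∖-sound u∈))) ⟩
    suc (count (adj G v))            ≡⟨ cong suc (degree≡count v) ⟨
    suc (degree G v)                 ∎
    where open ≤-Reasoning

  no-four-neighbours : (∀ v → degree G v ≤ 3) →
                       ∀ {v x₁ x₂ x₃ x₄} → v ~ x₁ → v ~ x₂ → v ~ x₃ → v ~ x₄ →
                       x₁ ≢ x₂ → x₁ ≢ x₃ → x₁ ≢ x₄ → x₂ ≢ x₃ → x₂ ≢ x₄ → x₃ ≢ x₄ → ⊥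
  no-four-neighbours maxdeg {v} a₁ a₂ a₃ a₄ d₁₂ d₁₃ d₁₄ d₂₃ d₂₄ d₃₄ =
    <⇒≱ (s≤s (maxdeg v)) (begin
    4               ≤⟨ length≤count (_ ∷ _ ∷ _ ∷ _ ∷ [])
                         ((d₁₂ ∷ d₁₃ ∷ d₁₄ ∷ []) ∷ (d₂₃ ∷ d₂₄ ∷ []) ∷ (d₃₄ ∷ []) ∷ [] ∷ [])
                         (a₁ ∷ a₂ ∷ a₃ ∷ a₄ ∷ []) ⟩
    count (adj G v) ≡⟨ degree≡count v ⟨
    degree G v      ∎)
    where open ≤-Reasoning

  nbrs : (V → ℕ) → V → ℕ
  nbrs y v = ∑[ u < n G ] (y u * 𝟙 (adj G v u))

  -- On indicator weights, arcs counts ordered adjacent pairs: each edge inside a set twice.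
  arcs : (V → ℕ) → (V → ℕ) → ℕ
  arcs x y = ∑[ v < n G ] (x v * nbrs y v)

  nbrs-cong : ∀ {y y′} → y ≗ y′ → ∀ v → nbrs y v ≡ nbrs y′ v
  nbrs-cong y≗y′ v = sum-cong-≗ (λ u → cong (_* 𝟙 (adj G v u)) (y≗y′ u))

  nbrs-⊕ : ∀ y y′ v → nbrs (y ⊕ y′) v ≡ nbrs y v + nbrs y′ v
  nbrs-⊕ y y′ v = trans (sum-cong-≗ (λ u → *-distribʳ-+ (𝟙 (adj G v u)) (y u) (y′ u)))
                        (∑-distrib-+ (λ u → y u * 𝟙 (adj G v u)) (λ u → y′ u * 𝟙 (adj G v u)))

  nbrs≤degree : ∀ {y} → (∀ u → y u ≤ 1) → ∀ v → nbrs y v ≤ degree G v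
  nbrs≤degree {y} y≤1 v = begin
    nbrs y v        ≤⟨ ∑-mono-≤ (λ u → ≤-trans (*-monoˡ-≤ (𝟙 (adj G v u)) (y≤1 u))
                                           (≤-reflexive (*-identityˡ (𝟙 (adj G v u))))) ⟩
    count (adj G v) ≡⟨ degree≡count v ⟨
    degree G v      ∎
    where open ≤-Reasoning

  nbrs-pos : ∀ {X : V → Bool} {u v} → T (X u) → v ~ u → 1 ≤ nbrs (χ X) v
  nbrs-pos {X} {u} {v} Xu v~u = begin
    1                     ≡⟨ cong₂ _*_ (χ-∈ {X = X} Xu) (χ-∈ {X = adj G v} v~u) ⟨
    χ X u * 𝟙 (adj G v u) ≤⟨ term≤∑ (λ (w : V) → χ X w * 𝟙 (adj G v w)) u ⟩
    nbrs (χ X) v          ∎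
    where open ≤-Reasoning

  nbrs≡count : ∀ Y v → nbrs (χ Y) v ≡ count (λ u → Y u ∧ adj G v u)
  nbrs≡count Y v = sum-cong-≗ pointwise
    where
    pointwise : ∀ u → χ Y u * 𝟙 (adj G v u) ≡ χ (λ w → Y w ∧ adj G v w) u
    pointwise u with Y u | adj G v u
    ... | true  | true  = refl
    ... | true  | false = refl
    ... | false | _     = refl

  nbrs≤1 : ∀ {Y : V → Bool} {v} → (∀ {x y} → T (Y x) → T (Y y) → v ~ x → v ~ y → x ≡ y) →
           nbrs (χ Y) v ≤ 1
  nbrs≤1 {Y} {v} unique = ≤-trans (≤-reflexive (nbrs≡count Y v)) (count≤1 λ x∈ y∈ →
    let (Yx , v~x) = to T-∧ x∈ ; (Yy , v~y) = to T-∧ y∈ in unique Yx Yy v~x v~y)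

  arcs-cong : ∀ {x x′ y y′} → x ≗ x′ → y ≗ y′ → arcs x y ≡ arcs x′ y′
  arcs-cong x≗x′ y≗y′ = sum-cong-≗ (λ v → cong₂ _*_ (x≗x′ v) (nbrs-cong y≗y′ v))

  arcs-⊕ˡ : ∀ x x′ y → arcs (x ⊕ x′) y ≡ arcs x y + arcs x′ y
  arcs-⊕ˡ x x′ y = trans (sum-cong-≗ (λ v → *-distribʳ-+ (nbrs y v) (x v) (x′ v)))
                         (∑-distrib-+ (λ v → x v * nbrs y v) (λ v → x′ v * nbrs y v))

  arcs-⊕ʳ : ∀ x y y′ → arcs x (y ⊕ y′) ≡ arcs x y + arcs x y′
  arcs-⊕ʳ x y y′ = trans (sum-cong-≗ (λ v → trans (cong (x v *_) (nbrs-⊕ y y′ v)) (*-distribˡ-+ (x v) _ _)))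
                         (∑-distrib-+ (λ v → x v * nbrs y v) (λ v → x v * nbrs y′ v))

  arcs-sym : ∀ x y → arcs x y ≡ arcs y x
  arcs-sym x y = begin
    ∑[ v < n G ] (x v * ∑[ u < n G ] (y u * 𝟙 (adj G v u)))
      ≡⟨ sum-cong-≗ (λ v → *-distribˡ-sum (x v) (λ u → y u * 𝟙 (adj G v u))) ⟩
    ∑[ v < n G ] ∑[ u < n G ] (x v * (y u * 𝟙 (adj G v u)))
      ≡⟨ ∑-comm (λ v u → x v * (y u * 𝟙 (adj G v u))) ⟩
    ∑[ u < n G ] ∑[ v < n G ] (x v * (y u * 𝟙 (adj G v u)))
      ≡⟨ sum-cong-≗ (λ u → sum-cong-≗ (λ v → swap u v)) ⟩
    ∑[ u < n G ] ∑[ v < n G ] (y u * (x v * 𝟙 (adj G u v)))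
      ≡⟨ sum-cong-≗ (λ u → *-distribˡ-sum (y u) (λ v → x v * 𝟙 (adj G u v))) ⟨
    ∑[ u < n G ] (y u * ∑[ v < n G ] (x v * 𝟙 (adj G u v)))
      ∎
    where
    open ≡-Reasoning
    swap : ∀ u v → x v * (y u * 𝟙 (adj G v u)) ≡ y u * (x v * 𝟙 (adj G u v))
    swap u v = trans (x∙yz≈y∙xz (x v) (y u) _) (cong (λ b → y u * (x v * 𝟙 b)) (Graph.sym G v u))

  arcs-∪ : ∀ (X Y : V → Bool) → (∀ v → ¬ (T (X v) × T (Y v))) →
           arcs (χ (X ∪ᵇ Y)) (χ (X ∪ᵇ Y)) ≡ arcs (χ X) (χ X) + 2 * arcs (χ X) (χ Y) + arcs (χ Y) (χ Y)
  arcs-∪ X Y disjoint = begin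
    arcs (χ (X ∪ᵇ Y)) (χ (X ∪ᵇ Y))            ≡⟨ arcs-cong (χ-∪ X Y disjoint) (χ-∪ X Y disjoint) ⟩
    arcs (x ⊕ y) (x ⊕ y)                      ≡⟨ arcs-⊕ˡ x y (x ⊕ y) ⟩
    arcs x (x ⊕ y) + arcs y (x ⊕ y)           ≡⟨ cong₂ _+_ (arcs-⊕ʳ x x y) (arcs-⊕ʳ y x y) ⟩
    (arcs x x + arcs x y) + (arcs y x + arcs y y) ≡⟨ cong (λ a → arcs x x + arcs x y + (a + arcs y y)) (arcs-sym y x) ⟩
    (arcs x x + arcs x y) + (arcs x y + arcs y y) ≡⟨ regroup (arcs x x) (arcs x y) (arcs y y) ⟩
    arcs x x + 2 * arcs x y + arcs y y        ∎
    where
    open ≡-Reasoning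
    x y : V → ℕ
    x = χ X
    y = χ Y
    regroup : ∀ a b c → (a + b) + (b + c) ≡ a + 2 * b + c
    regroup = +-*-Solver.solve 3 (λ a b c → (a :+ b) :+ (b :+ c) := a :+ con 2 :* b :+ c) refl
      where open +-*-Solver

  arcs-⁅⁆ˡ : ∀ v y → arcs (χ ⁅ v ⁆) y ≡ nbrs y v
  arcs-⁅⁆ˡ v y = ∑-sift v (nbrs y)

  arcs≤ : ∀ {X : V → Bool} {y} k → (∀ v → T (X v) → nbrs y v ≤ k) → arcs (χ X) y ≤ k * count X
  arcs≤ {X} {y} k bound = begin
    arcs (χ X) y             ≤⟨ ∑-mono-≤ pointwise ⟩
    ∑[ v < n G ] (k * χ X v) ≡⟨ ∑-*ˡ k (χ X) ⟩
    k * count X              ∎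
    where
    open ≤-Reasoning
    pointwise : ∀ v → χ X v * nbrs y v ≤ k * χ X v
    pointwise v with X v | bound v
    ... | true  | b = subst₂ _≤_ (sym (*-identityˡ _)) (sym (*-identityʳ k)) (b _)
    ... | false | _ = z≤n

  arcs-pos : ∀ {X Y : V → Bool} {x y} → T (X x) → T (Y y) → x ~ y → 1 ≤ arcs (χ X) (χ Y)
  arcs-pos {X} {Y} {x} Xx Yy x~y = begin
    1                    ≤⟨ nbrs-pos {Y} Yy x~y ⟩
    nbrs (χ Y) x         ≡⟨ *-identityˡ _ ⟨
    1 * nbrs (χ Y) x     ≡⟨ cong (_* nbrs (χ Y) x) (χ-∈ {X = X} Xx) ⟨
    χ X x * nbrs (χ Y) x ≤⟨ term≤∑ (λ (v : V) → χ X v * nbrs (χ Y) v) x ⟩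
    arcs (χ X) (χ Y)     ∎
    where open ≤-Reasoning

  -- Connectivity: growing a spanning tree

  module Growth (S : V → Bool) (v₀ : V) where

    -- Each grown vertex brings at least one edge, i.e. two arcs: a connected set on c
    -- vertices spans at least c − 1 edges.
    record Grown (R : V → Bool) : Set where
      field
        R⊆S        : ∀ {u} → T (R u) → T (S u)
        reachable  : ∀ {u} → T (R u) → WalkIn G (T ∘ S) v₀ u
        tree-bound : 2 * count R ≤ arcs (χ R) (χ R) + 2

    Frontier : (V → Bool) → V → Set
    Frontier R v = T (S v) × ¬ T (R v) × ∃ λ x → T (R x) × x ~ v

    frontier? : ∀ R v → Dec (Frontier R v)
    frontier? R v = T? (S v) ×-dec ¬? (T? (R v)) ×-dec any? (λ x → T? (R x) ×-dec T? (adj G x v))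

    apart : ∀ (R : V → Bool) v → ¬ T (R v) → ∀ u → ¬ (T (R u) × T (⁅ v ⁆ u))
    apart R v ¬Rv u (Ru , v≡u) = ¬Rv (subst (T ∘ R) (sym (⁅⁆-sound v≡u)) Ru)

    count-+1 : ∀ (R : V → Bool) v → ¬ T (R v) → count (R ∪ᵇ ⁅ v ⁆) ≡ suc (count R)
    count-+1 R v ¬Rv =
      trans (count-∪ R ⁅ v ⁆ (apart R v ¬Rv)) (trans (cong (count R +_) (count-⁅⁆ v)) (+-comm (count R) 1))

    count<n : ∀ (R : V → Bool) v → ¬ T (R v) → count R < n G
    count<n R v ¬Rv = begin-strict
      count R                  <⟨ n<1+n (count R) ⟩
      suc (count R)            ≡⟨ count-+1 R v ¬Rv ⟨
      count (R ∪ᵇ ⁅ v ⁆)       ≤⟨ count-mono {n G} {Y = λ _ → true} (λ _ _ → _) ⟩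
      count {n G} (λ _ → true) ≡⟨ count-all (n G) ⟩
      n G                      ∎
      where open ≤-Reasoning

    arcs-+2 : ∀ {R v} → Frontier R v → arcs (χ R) (χ R) + 2 ≤ arcs (χ (R ∪ᵇ ⁅ v ⁆)) (χ (R ∪ᵇ ⁅ v ⁆))
    arcs-+2 {R} {v} (_ , ¬Rv , x , Rx , x~v) = begin
      arcs r r + 2 * 1                        ≤⟨ +-monoʳ-≤ (arcs r r) (*-monoʳ-≤ 2 into-v) ⟩
      arcs r r + 2 * arcs r s                 ≤⟨ m≤m+n _ (arcs s s) ⟩
      arcs r r + 2 * arcs r s + arcs s s      ≡⟨ arcs-∪ R ⁅ v ⁆ (apart R v ¬Rv) ⟨
      arcs (χ (R ∪ᵇ ⁅ v ⁆)) (χ (R ∪ᵇ ⁅ v ⁆)) ∎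
      where
      open ≤-Reasoning
      r s : V → ℕ
      r = χ R
      s = χ ⁅ v ⁆
      into-v : 1 ≤ arcs r s
      into-v = begin
        1          ≤⟨ nbrs-pos {R} Rx (~-sym x~v) ⟩
        nbrs r v   ≡⟨ arcs-⁅⁆ˡ v r ⟨
        arcs s r   ≡⟨ arcs-sym s r ⟩
        arcs r s   ∎

    extend : ∀ {R v} → Grown R → Frontier R v → Grown (R ∪ᵇ ⁅ v ⁆)
    extend {R} {v} grown fr@(Sv , ¬Rv , x , Rx , x~v) = record
      { R⊆S        = [ R⊆S , (λ v≡u → subst (T ∘ S) (⁅⁆-sound v≡u) Sv) ] ∘ to T-∨
      ; reachable  = [ reachable , (λ v≡u → subst (WalkIn G (T ∘ S) v₀) (⁅⁆-sound v≡u)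
                                                 (walk-snoc (reachable Rx) Sv x~v)) ] ∘ to T-∨
      ; tree-bound = begin
          2 * count (R ∪ᵇ ⁅ v ⁆)                     ≡⟨ cong (2 *_) (count-+1 R v ¬Rv) ⟩
          2 * suc (count R)                          ≡⟨ *-suc 2 (count R) ⟩
          2 + 2 * count R                            ≤⟨ +-monoʳ-≤ 2 tree-bound ⟩
          2 + (arcs (χ R) (χ R) + 2)                 ≡⟨ +-comm 2 _ ⟩
          arcs (χ R) (χ R) + 2 + 2                   ≤⟨ +-monoˡ-≤ 2 (arcs-+2 fr) ⟩
          arcs (χ (R ∪ᵇ ⁅ v ⁆)) (χ (R ∪ᵇ ⁅ v ⁆)) + 2 ∎
      }
      where
      open Grown grown
      open ≤-Reasoning

    start : T (S v₀) → Grown ⁅ v₀ ⁆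
    start Sv₀ = record
      { R⊆S        = λ v₀≡u → subst (T ∘ S) (⁅⁆-sound v₀≡u) Sv₀
      ; reachable  = λ v₀≡u → subst (WalkIn G (T ∘ S) v₀) (⁅⁆-sound v₀≡u) (here Sv₀)
      ; tree-bound = subst (λ c → 2 * c ≤ arcs (χ ⁅ v₀ ⁆) (χ ⁅ v₀ ⁆) + 2) (sym (count-⁅⁆ v₀))
                           (m≤n+m 2 (arcs (χ ⁅ v₀ ⁆) (χ ⁅ v₀ ⁆)))
      }

    data Outcome : Set where
      spanning : ∀ {R} → Grown R → (∀ {u} → T (S u) → T (R u)) → Outcome
      cut      : ∀ {w} → T (S w) → ¬ WalkIn G (T ∘ S) v₀ w → Outcome

    grow : (fuel : ℕ) (R : V → Bool) → Grown R → T (R v₀) → n G ≤ count R + fuel → Outcome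
    grow fuel R grown R₀ enough with any? (frontier? R)
    grow zero       R grown R₀ enough | yes (v , (_ , ¬Rv , _)) =
      ⊥-elim (<⇒≱ (count<n R v ¬Rv) (≤-trans enough (≤-reflexive (+-identityʳ (count R)))))
    grow (suc fuel) R grown R₀ enough | yes (v , fr@(_ , ¬Rv , _)) =
      grow fuel (R ∪ᵇ ⁅ v ⁆) (extend grown fr) (from T-∨ (inj₁ R₀))
           (≤-trans enough (≤-reflexive (trans (+-suc (count R) fuel) (cong (_+ fuel) (sym (count-+1 R v ¬Rv))))))
    grow fuel R grown R₀ enough | no no-frontier with any? (λ w → T? (S w) ×-dec ¬? (T? (R w)))
    ... | yes (w , Sw , ¬Rw) = cut Sw λ walk →
      let (x , y , Rx , ¬Ry , Sy , x~y) = walk-exit R walk R₀ ¬Rw in no-frontier (y , Sy , ¬Ry , x , Rx , x~y)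
    ... | no none-outside = spanning grown λ {u} Su → decidable-stable (T? (R u)) (λ ¬Ru → none-outside (u , Su , ¬Ru))

    run : T (S v₀) → Outcome
    run Sv₀ = grow (n G) ⁅ v₀ ⁆ (start Sv₀) (⁅⁆-refl v₀) (m≤n+m (n G) _)

  connected? : (S : V → Bool) → Dec (InducedConnected G (T ∘ S))
  connected? S with any? (λ v → T? (S v))
  ... | no empty = yes (λ u _ Su _ → ⊥-elim (empty (u , Su)))
  ... | yes (v₀ , Sv₀) with Growth.run S v₀ Sv₀
  ... | Growth.spanning grown covers = yes λ u w Su Sw →
          walk-++ (walk-reverse (reachable (covers Su))) (reachable (covers Sw))
    where open Growth.Grown grown
  ... | Growth.cut Sw no-walk = no λ connected → no-walk (connected v₀ _ Sv₀ Sw)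

  connected⇒arcs-bound : ∀ {S v₀} → T (S v₀) → InducedConnected G (T ∘ S) →
                         2 * count S ≤ arcs (χ S) (χ S) + 2
  connected⇒arcs-bound {S} {v₀} Sv₀ connected with Growth.run S v₀ Sv₀
  ... | Growth.cut Sw no-walk = ⊥-elim (no-walk (connected v₀ _ Sv₀ Sw))
  ... | Growth.spanning {R} grown covers =
          subst₂ (λ c a → 2 * c ≤ a + 2) (sum-cong-≗ R≗S) (arcs-cong R≗S R≗S) tree-bound
    where
    open Growth.Grown grown
    R≗S : χ R ≗ χ S
    R≗S u = cong 𝟙 (T-ext R⊆S covers)

  inducedConnected? : ∀ {P : VSet G} → (∀ v → Dec (P v)) → Dec (InducedConnected G P)
  inducedConnected? P? =
    map′ (connected-resp toWitness fromWitness) (connected-resp fromWitness toWitness) (connected? (λ v → ⌊ P? v ⌋))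

  dominating? : ∀ {P : VSet G} → (∀ v → Dec (P v)) → Dec (Dominating G P)
  dominating? P? = all? λ v → ¬? (P? v) →-dec any? λ u → P? u ×-dec T? (adj G u v)

  connDominating? : ∀ {P : VSet G} → (∀ v → Dec (P v)) → Dec (ConnDominating G P)
  connDominating? P? = dominating? P? ×-dec inducedConnected? P?

  matching-bound : ∀ {Y : V → Bool} {y₀} → T (Y y₀) → (∀ v → T (Y v) → nbrs (χ Y) v ≤ 1) →
                   arcs (χ Y) (χ Y) + 2 ≤ 2 * count Y
  matching-bound {Y} {y₀} Yy₀ sparse with any? (λ x → any? (λ y → T? (Y x) ×-dec T? (Y y) ×-dec T? (adj G x y)))
  ... | yes (x , y , Yx , Yy , x~y) = begin
    arcs (χ Y) (χ Y) + 2 ≤⟨ +-mono-≤ (≤-trans (arcs≤ {Y} {χ Y} 1 sparse) (≤-reflexive (*-identityˡ (count Y))))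
                                 two≤count ⟩
    count Y + count Y    ≡⟨ cong (count Y +_) (+-identityʳ (count Y)) ⟨
    2 * count Y          ∎
    where
    open ≤-Reasoning
    two≤count : 2 ≤ count Y
    two≤count = length≤count (x ∷ y ∷ []) ((~-irrefl x~y ∷ []) ∷ [] ∷ []) (Yx ∷ Yy ∷ [])
  ... | no no-edge = begin
    arcs (χ Y) (χ Y) + 2 ≤⟨ +-monoˡ-≤ 2 (arcs≤ {Y} {χ Y} 0 no-inner-arc) ⟩
    2                    ≤⟨ *-monoʳ-≤ 2 (length≤count (y₀ ∷ []) ([] ∷ []) (Yy₀ ∷ [])) ⟩
    2 * count Y          ∎
    where
    open ≤-Reasoning
    no-inner-arc : ∀ v → T (Y v) → nbrs (χ Y) v ≤ 0
    no-inner-arc v Yv = ≤-reflexive (trans (nbrs≡count Y v) (count-none λ u u∈ →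
      let (Yu , v~u) = to T-∧ u∈ in no-edge (v , u , Yv , Yu , v~u)))

  union-arcs-bound : ∀ {X Y : V → Bool} {y₀} → (∀ v → ¬ (T (X v) × T (Y v))) → T (Y y₀) →
                     InducedConnected G (T ∘ (X ∪ᵇ Y)) → (∀ v → T (Y v) → nbrs (χ Y) v ≤ 1) →
                     2 * count X ≤ arcs (χ X) (χ X) + 2 * arcs (χ X) (χ Y)
  union-arcs-bound {X} {Y} {y₀} disjoint Yy₀ connected sparse =
    +-cancelʳ-≤ (arcs (χ Y) (χ Y) + 2) (2 * count X) (arcs (χ X) (χ X) + 2 * arcs (χ X) (χ Y)) (begin
      2 * count X + (arcs (χ Y) (χ Y) + 2)     ≤⟨ +-monoʳ-≤ (2 * count X) (matching-bound Yy₀ sparse) ⟩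
      2 * count X + 2 * count Y                ≡⟨ *-distribˡ-+ 2 (count X) (count Y) ⟨
      2 * (count X + count Y)                  ≡⟨ cong (2 *_) (count-∪ X Y disjoint) ⟨
      2 * count (X ∪ᵇ Y)                       ≤⟨ connected⇒arcs-bound (from T-∨ (inj₂ Yy₀)) connected ⟩
      arcs (χ (X ∪ᵇ Y)) (χ (X ∪ᵇ Y)) + 2       ≡⟨ cong (_+ 2) (arcs-∪ X Y disjoint) ⟩
      arcs (χ X) (χ X) + 2 * arcs (χ X) (χ Y) + arcs (χ Y) (χ Y) + 2
                                               ≡⟨ +-assoc (arcs (χ X) (χ X) + 2 * arcs (χ X) (χ Y)) _ 2 ⟩
      arcs (χ X) (χ X) + 2 * arcs (χ X) (χ Y) + (arcs (χ Y) (χ Y) + 2) ∎)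
    where open ≤-Reasoning

module Classes (G : Graph) {k : ℕ} (part : Fin (n G) → Fin k) (nonempty : ∀ i → ∃ λ v → part v ≡ i) where

  open GraphLemmas G

  Cl : Fin k → VSet G
  Cl = Class G part

  Pair : Fin k → Fin k → VSet G
  Pair i j = _∪_ {G} (Cl i) (Cl j)

  CD : VSet G → Set
  CD = ConnDominating G

  class? : ∀ i v → Dec (Cl i v)
  class? i v = part v ≟ i

  pair? : ∀ i j v → Dec (Pair i j v)
  pair? i j v = class? i v ⊎-dec class? j v

  classᵇ : Fin k → V → Bool
  classᵇ i v = ⌊ class? i v ⌋

  pair⇒T : ∀ {i j v} → Pair i j v → T ((classᵇ i ∪ᵇ classᵇ j) v)
  pair⇒T {i} {j} {v} = from (T-∨ {classᵇ i v} {classᵇ j v}) ∘ Sum.map fromWitness fromWitness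

  T⇒pair : ∀ {i j v} → T ((classᵇ i ∪ᵇ classᵇ j) v) → Pair i j v
  T⇒pair {i} {j} {v} = Sum.map toWitness toWitness ∘ to (T-∨ {classᵇ i v} {classᵇ j v})

  rep : Fin k → V
  rep i = proj₁ (nonempty i)

  rep∈ : ∀ i → Cl i (rep i)
  rep∈ i = proj₂ (nonempty i)

  rep-class : ∀ i {x} → rep i ≡ x → i ≡ part x
  rep-class i rep≡x = trans (sym (rep∈ i)) (cong part rep≡x)

  ≢-by-class : ∀ {i j x y} → Cl i x → Cl j y → i ≢ j → x ≢ y
  ≢-by-class x∈i y∈j i≢j refl = i≢j (trans (sym x∈i) y∈j)

  class-≢-pair : ∀ {i j c x u} → Cl c x → Pair i j u → c ≢ i → c ≢ j → part x ≢ part u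
  class-≢-pair x∈c (inj₁ u∈i) c≢i _   x≡u = c≢i (trans (sym x∈c) (trans x≡u u∈i))
  class-≢-pair x∈c (inj₂ u∈j) _   c≢j x≡u = c≢j (trans (sym x∈c) (trans x≡u u∈j))

  ≢-by-pair : ∀ {i j c x u} → Cl c x → Pair i j u → c ≢ i → c ≢ j → x ≢ u
  ≢-by-pair x∈c u∈ c≢i c≢j = class-≢-pair x∈c u∈ c≢i c≢j ∘ cong part

  pair-sym : ∀ {i j} → CD (Pair i j) → CD (Pair j i)
  pair-sym = connDominating-resp Sum.swap Sum.swap

  pair-partner : ∀ {i j} → i ≢ j → ∀ v → ∃ λ w → Pair i j w × v ≢ w
  pair-partner {i} {j} i≢j v with v ≟ rep i
  ... | no  v≢i  = rep i , inj₁ (rep∈ i) , v≢i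
  ... | yes refl = rep j , inj₂ (rep∈ j) , ≢-by-class (rep∈ i) (rep∈ j) i≢j

  neighbour-in-pair : ∀ {i j} → i ≢ j → CD (Pair i j) → ∀ v → ∃ λ u → Pair i j u × v ~ u
  neighbour-in-pair {i} {j} i≢j (dominating , connected) v with pair? i j v
  ... | no v∉ = let (u , u∈ , u~v) = dominating v v∉ in u , u∈ , ~-sym u~v
  ... | yes v∈ with pair-partner i≢j v
  ...   | w , w∈ , v≢w with connected v w v∈ w∈
  ...     | here _          = ⊥-elim (v≢w refl)
  ...     | step _ v~u walk = _ , walk-start walk , v~u

  coalition-irrefl : ∀ {i} → ¬ CCGAdj G part i i
  coalition-irrefl {i} (disjoint , _) = disjoint (rep i) (rep∈ i) (rep∈ i)

  coalition? : ∀ i j → Dec (CCGAdj G part i j)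
  coalition? i j = disjoint? ×-dec ¬? (connDominating? (class? i)) ×-dec ¬? (connDominating? (class? j))
                   ×-dec connDominating? (pair? i j)
    where
    disjoint? : Dec (Disjoint {G} (Cl i) (Cl j))
    disjoint? = map′ (λ never v x∈i x∈j → never v (x∈i , x∈j))
                     (λ disjoint v (x∈i , x∈j) → disjoint v x∈i x∈j)
                     (all? λ v → ¬? (class? i v ×-dec class? j v))

  k≤n : k ≤ n G
  k≤n = injective⇒≤ {f = rep} λ {i} {j} rep-i≡rep-j → trans (rep-class i rep-i≡rep-j) (rep∈ j)

  singleton-dominating⇒k≤suc-degree : ∀ {i v} → Dominating G (Cl i) → (∀ u → Cl i u → u ≡ v) →
                                      k ≤ suc (degree G v)
  singleton-dominating⇒k≤suc-degree {i} {v} dominating single = ≤-trans k≤n (n≤suc-degree adjacent)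
    where
    adjacent : ∀ u → v ≢ u → v ~ u
    adjacent u v≢u with class? i u
    ... | yes u∈ = ⊥-elim (v≢u (sym (single u u∈)))
    ... | no  u∉ with dominating u u∉
    ...   | w , w∈ , w~u = subst (_~ u) (single w w∈) w~u

relabel-class : ∀ {G : Graph} {k} (part : Fin (n G) → Fin k) (σ : Permutation′ k) {i v} →
                Class G part (σ ⟨$⟩ʳ i) v → Class G ((σ ⟨$⟩ˡ_) ∘ part) i v
relabel-class part σ v∈ = trans (cong (σ ⟨$⟩ˡ_) v∈) (inverseˡ σ)

unrelabel-class : ∀ {G : Graph} {k} (part : Fin (n G) → Fin k) (σ : Permutation′ k) {i v} →
                  Class G ((σ ⟨$⟩ˡ_) ∘ part) i v → Class G part (σ ⟨$⟩ʳ i) v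
unrelabel-class part σ v∈ = trans (sym (inverseʳ σ)) (cong (σ ⟨$⟩ʳ_) v∈)

relabel-coalition : ∀ {G : Graph} {k} {part : Fin (n G) → Fin k} (σ : Permutation′ k) {i j} →
                    CCGAdj G part (σ ⟨$⟩ʳ i) (σ ⟨$⟩ʳ j) → CCGAdj G ((σ ⟨$⟩ˡ_) ∘ part) i j
relabel-coalition {G} {part = part} σ =
  coalition-resp (relabel-class {G} part σ) (unrelabel-class {G} part σ)
                 (relabel-class {G} part σ) (unrelabel-class {G} part σ)
  where open GraphLemmas G

-- In H, no vertex of degree four has a neighbour of degree three

arcs-into-E-vanish : ∀ b r₁ r₂ r₃ r₄ → r₁ + (r₂ + (r₃ + r₄)) ≤ 2 * b →
                     2 * b ≤ r₁ + 2 * r₂ → 2 * b ≤ r₁ + 2 * r₃ → r₄ ≡ 0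
arcs-into-E-vanish b r₁ r₂ r₃ r₄ budget via-C via-D =
  n≤0⇒n≡0 (≤-trans (m≤m+n r₄ (r₄ + 0)) (+-cancelˡ-≤ L (2 * r₄) 0 (begin
    L + 2 * r₄                  ≡⟨ regroup r₁ r₂ r₃ r₄ ⟩
    2 * (r₁ + (r₂ + (r₃ + r₄))) ≤⟨ *-monoʳ-≤ 2 budget ⟩
    2 * (2 * b)                 ≡⟨ cong (2 * b +_) (+-identityʳ (2 * b)) ⟩
    2 * b + 2 * b               ≤⟨ +-mono-≤ via-C via-D ⟩
    L                           ≡⟨ +-identityʳ L ⟨
    L + 0                       ∎)))
  where
  open ≤-Reasoning
  L : ℕ
  L = (r₁ + 2 * r₂) + (r₁ + 2 * r₃)
  regroup : ∀ r₁ r₂ r₃ r₄ → (r₁ + 2 * r₂) + (r₁ + 2 * r₃) + 2 * r₄ ≡ 2 * (r₁ + (r₂ + (r₃ + r₄)))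
  regroup = solve 4 (λ r₁ r₂ r₃ r₄ → (r₁ :+ con 2 :* r₂) :+ (r₁ :+ con 2 :* r₃) :+ con 2 :* r₄
                                     := con 2 :* (r₁ :+ (r₂ :+ (r₃ :+ r₄)))) refl
    where open +-*-Solver

not-0F-split : ∀ (c : Fin 5) →
               𝟙 (not ⌊ c ≟ 0F ⌋) ≡ 𝟙 ⌊ c ≟ 1F ⌋ + (𝟙 ⌊ c ≟ 2F ⌋ + (𝟙 ⌊ c ≟ 3F ⌋ + 𝟙 ⌊ c ≟ 4F ⌋))
not-0F-split 0F = refl
not-0F-split 1F = refl
not-0F-split 2F = refl
not-0F-split 3F = refl
not-0F-split 4F = refl

module StarFree (G : Graph) (maxdeg : ∀ v → degree G v ≤ 3)
                (part : Fin (n G) → Fin 5) (nonempty : ∀ i → ∃ λ v → part v ≡ i) where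

  open GraphLemmas G
  open Classes G part nonempty

  module _ (cd01 : CD (Pair 0F 1F)) (cd02 : CD (Pair 0F 2F)) (cd03 : CD (Pair 0F 3F)) (cd04 : CD (Pair 0F 4F))
           (cd12 : CD (Pair 1F 2F)) (cd13 : CD (Pair 1F 3F)) (¬cd0 : ¬ CD (Cl 0F)) where

    A-neighbour : ∀ v → ∃ λ a → Cl 0F a × v ~ a
    A-neighbour v with neighbour-in-pair (λ ()) cd01 v | neighbour-in-pair (λ ()) cd02 v
                     | neighbour-in-pair (λ ()) cd03 v | neighbour-in-pair (λ ()) cd04 v
    ... | u , inj₁ u∈A , v~u | _ | _ | _ = u , u∈A , v~u
    ... | _ | u , inj₁ u∈A , v~u | _ | _ = u , u∈A , v~u
    ... | _ | _ | u , inj₁ u∈A , v~u | _ = u , u∈A , v~u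
    ... | _ | _ | _ | u , inj₁ u∈A , v~u = u , u∈A , v~u
    ... | u₁ , inj₂ u₁∈ , v~u₁ | u₂ , inj₂ u₂∈ , v~u₂
        | u₃ , inj₂ u₃∈ , v~u₃ | u₄ , inj₂ u₄∈ , v~u₄ =
      ⊥-elim (no-four-neighbours maxdeg v~u₁ v~u₂ v~u₃ v~u₄
        (≢-by-class u₁∈ u₂∈ (λ ())) (≢-by-class u₁∈ u₃∈ (λ ())) (≢-by-class u₁∈ u₄∈ (λ ()))
        (≢-by-class u₂∈ u₃∈ (λ ())) (≢-by-class u₂∈ u₄∈ (λ ())) (≢-by-class u₃∈ u₄∈ (λ ())))

    at-most-one-neighbour-in : ∀ {c o} → c ≢ 0F → c ≢ 1F → c ≢ o → o ≢ 0F → 1F ≢ o → CD (Pair 1F o) →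
                               ∀ {v x y} → Cl c v → Cl c x → Cl c y → v ~ x → v ~ y → x ≡ y
    at-most-one-neighbour-in c≢0 c≢1 c≢o o≢0 1≢o cd1o {v} {x} {y} _ x∈ y∈ v~x v~y with x ≟ y
    ... | yes x≡y = x≡y
    ... | no  x≢y with A-neighbour v | neighbour-in-pair 1≢o cd1o v
    ...   | a , a∈A , v~a | u , u∈ , v~u = ⊥-elim (no-four-neighbours maxdeg v~x v~y v~a v~u
            x≢y (≢-by-class x∈ a∈A c≢0) (≢-by-pair x∈ u∈ c≢1 c≢o)
                (≢-by-class y∈ a∈A c≢0) (≢-by-pair y∈ u∈ c≢1 c≢o)
            (≢-by-pair a∈A u∈ (λ ()) (o≢0 ∘ sym)))

    B-arcs-bound : ∀ {c o} → c ≢ 0F → c ≢ 1F → c ≢ o → o ≢ 0F → 1F ≢ o → CD (Pair 1F c) → CD (Pair 1F o) →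
                   let B = classᵇ 1F in 2 * count B ≤ arcs (χ B) (χ B) + 2 * arcs (χ B) (χ (classᵇ c))
    B-arcs-bound {c} c≢0 c≢1 c≢o o≢0 1≢o cd1c cd1o =
      union-arcs-bound {X = classᵇ 1F} {Y = classᵇ c} {y₀ = rep c}
        disjoint (fromWitness (rep∈ c)) (connected-resp pair⇒T T⇒pair (proj₂ cd1c)) sparse
      where
      disjoint : ∀ v → ¬ (T (classᵇ 1F v) × T (classᵇ c v))
      disjoint v (v∈B , v∈c) = c≢1 (trans (sym (toWitness v∈c)) (toWitness v∈B))
      sparse : ∀ v → T (classᵇ c v) → nbrs (χ (classᵇ c)) v ≤ 1
      sparse v v∈c = nbrs≤1 {classᵇ c} λ x∈ y∈ → at-most-one-neighbour-in c≢0 c≢1 c≢o o≢0 1≢o cd1o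
                                             (toWitness v∈c) (toWitness x∈) (toWitness y∈)

    Ā : V → Bool
    Ā = not ∘ classᵇ 0F

    non-A-neighbours≤2 : ∀ v → nbrs (χ Ā) v ≤ 2
    non-A-neighbours≤2 v with A-neighbour v
    ... | a , a∈A , v~a = +-cancelˡ-≤ 1 _ _ (begin
      1 + nbrs (χ Ā) v                      ≤⟨ +-monoˡ-≤ (nbrs (χ Ā) v) (nbrs-pos {classᵇ 0F} (fromWitness a∈A) v~a) ⟩
      nbrs (χ (classᵇ 0F)) v + nbrs (χ Ā) v ≡⟨ nbrs-⊕ (χ (classᵇ 0F)) (χ Ā) v ⟨
      nbrs (χ (classᵇ 0F) ⊕ χ Ā) v          ≤⟨ nbrs≤degree one v ⟩
      degree G v                            ≤⟨ maxdeg v ⟩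
      3                                     ∎)
      where
      open ≤-Reasoning
      one : ∀ u → (χ (classᵇ 0F) ⊕ χ Ā) u ≤ 1
      one u with classᵇ 0F u
      ... | true  = ≤-refl
      ... | false = ≤-refl

    -- Every vertex has a neighbour in A, so B sends at most 2|B| arcs out of A, while the
    -- connected unions B ∪ C and B ∪ D force arcs into C and D that leave none for E.
    no-B-E-edge : ∀ {b e} → Cl 1F b → Cl 4F e → ¬ b ~ e
    no-B-E-edge b∈B e∈E b~e =
      1+n≰n (subst (1 ≤_) r₄≡0 (arcs-pos {classᵇ 1F} {classᵇ 4F} (fromWitness b∈B) (fromWitness e∈E) b~e))
      where
      B : V → Bool
      B = classᵇ 1F
      c : Fin 5 → V → ℕ
      c i = χ (classᵇ i)
      r : Fin 5 → ℕ
      r i = arcs (χ B) (c i)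
      budget : r 1F + (r 2F + (r 3F + r 4F)) ≤ 2 * count B
      budget = begin
        r 1F + (r 2F + (r 3F + r 4F))          ≡⟨ cong (λ t → r 1F + (r 2F + t)) (arcs-⊕ʳ (χ B) (c 3F) (c 4F)) ⟨
        r 1F + (r 2F + arcs (χ B) (c 3F ⊕ c 4F)) ≡⟨ cong (r 1F +_) (arcs-⊕ʳ (χ B) (c 2F) (c 3F ⊕ c 4F)) ⟨
        r 1F + arcs (χ B) (c 2F ⊕ (c 3F ⊕ c 4F)) ≡⟨ arcs-⊕ʳ (χ B) (c 1F) (c 2F ⊕ (c 3F ⊕ c 4F)) ⟨
        arcs (χ B) (c 1F ⊕ (c 2F ⊕ (c 3F ⊕ c 4F))) ≡⟨ arcs-cong {χ B} (λ _ → refl) (not-0F-split ∘ part) ⟨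
        arcs (χ B) (χ Ā)                       ≤⟨ arcs≤ {B} {χ Ā} 2 (λ v _ → non-A-neighbours≤2 v) ⟩
        2 * count B                            ∎
        where open ≤-Reasoning
      r₄≡0 : r 4F ≡ 0
      r₄≡0 = arcs-into-E-vanish (count B) (r 1F) (r 2F) (r 3F) (r 4F) budget
               (B-arcs-bound (λ ()) (λ ()) (λ ()) (λ ()) (λ ()) cd12 cd13)
               (B-arcs-bound (λ ()) (λ ()) (λ ()) (λ ()) (λ ()) cd13 cd12)

    E-neighbours-in-C-and-D : ∀ {z} → Cl 4F z → ∃₂ λ c d → Cl 2F c × Cl 3F d × z ~ c × z ~ d
    E-neighbours-in-C-and-D {z} z∈E with neighbour-in-pair (λ ()) cd12 z | neighbour-in-pair (λ ()) cd13 z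
    ... | c , inj₁ c∈B , z~c | _                  = ⊥-elim (no-B-E-edge c∈B z∈E (~-sym z~c))
    ... | _                  | d , inj₁ d∈B , z~d = ⊥-elim (no-B-E-edge d∈B z∈E (~-sym z~d))
    ... | c , inj₂ c∈C , z~c | d , inj₂ d∈D , z~d = c , d , c∈C , d∈D , z~c , z~d

    E-pendant : ∀ {z w w′} → Cl 4F z → Pair 0F 4F w → Pair 0F 4F w′ → z ~ w → z ~ w′ → w ≡ w′
    E-pendant {z} z∈E with A-neighbour z | E-neighbours-in-C-and-D z∈E
    ... | a , a∈A , z~a | c , d , c∈C , d∈D , z~c , z~d =
      λ w∈ w′∈ z~w z~w′ → trans (only-a w∈ z~w) (sym (only-a w′∈ z~w′))
      where
      only-a : ∀ {w} → Pair 0F 4F w → z ~ w → w ≡ a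
      only-a {w} w∈ z~w with w ≟ a
      ... | yes w≡a = w≡a
      ... | no  w≢a = ⊥-elim (no-four-neighbours maxdeg z~w z~c z~d z~a
                        (≢-by-pair c∈C w∈ (λ ()) (λ ()) ∘ sym) (≢-by-pair d∈D w∈ (λ ()) (λ ()) ∘ sym) w≢a
                        (≢-by-class c∈C d∈D (λ ())) (≢-by-class c∈C a∈A (λ ()))
                        (≢-by-class d∈D a∈A (λ ())))

    star-free : ⊥
    star-free = ¬cd0 (dominating , connected)
      where
      dominating : Dominating G (Cl 0F)
      dominating v _ with A-neighbour v
      ... | a , a∈A , v~a = a , a∈A , ~-sym v~a
      connected : InducedConnected G (Cl 0F)
      connected x y x∈A y∈A = walk-prune (λ v∈A v∈E → ≢-by-class v∈A v∈E (λ ()) refl) E-pendant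
                                         (proj₂ cd04 x y (inj₁ x∈A) (inj₁ y∈A)) x∈A y∈A

-- In H, no triangle is disjoint from an edge

SClass : Fin 5 → Set
SClass i = i ≡ 3F ⊎ i ≡ 4F

TClass : Fin 5 → Set
TClass i = ¬ SClass i

TClass? : ∀ i → Dec (TClass i)
TClass? i = ¬? ((i ≟ 3F) ⊎-dec (i ≟ 4F))

-- opaque: proved by running the decision procedure, which must not be unfolded at use sites
opaque
  classes-meet : ∀ a b c d → a ≢ b → c ≢ d → TClass a → TClass b → TClass c → TClass d →
                 (∀ i → TClass i → i ≡ a ⊎ i ≡ b ⊎ i ≡ c ⊎ i ≡ d) →
                 (a ≡ c × b ≢ d) ⊎ (a ≡ d × b ≢ c) ⊎ (b ≡ c × a ≢ d) ⊎ (b ≡ d × a ≢ c)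
  classes-meet = from-yes (all? λ a → all? λ b → all? λ c → all? λ d →
    ¬? (a ≟ b) →-dec ¬? (c ≟ d) →-dec TClass? a →-dec TClass? b →-dec TClass? c →-dec TClass? d →-dec
    all? (λ i → TClass? i →-dec (i ≟ a ⊎-dec i ≟ b ⊎-dec i ≟ c ⊎-dec i ≟ d)) →-dec
    ((a ≟ c ×-dec ¬? (b ≟ d)) ⊎-dec (a ≟ d ×-dec ¬? (b ≟ c)) ⊎-dec
     (b ≟ c ×-dec ¬? (a ≟ d)) ⊎-dec (b ≟ d ×-dec ¬? (a ≟ c))))

module TriangleEdgeFree (G : Graph) (maxdeg : ∀ v → degree G v ≤ 3)
                        (part : Fin (n G) → Fin 5) (nonempty : ∀ i → ∃ λ v → part v ≡ i) where

  open GraphLemmas G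
  open Classes G part nonempty

  S : VSet G
  S = Pair 3F 4F

  module _ (cd01 : CD (Pair 0F 1F)) (cd02 : CD (Pair 0F 2F)) (cd12 : CD (Pair 1F 2F)) (cd34 : CD S)
           (¬cd0 : ¬ CD (Cl 0F)) (¬cd1 : ¬ CD (Cl 1F)) (¬cd2 : ¬ CD (Cl 2F)) where

    T0 : TClass 0F
    T0 (inj₁ ())
    T0 (inj₂ ())

    T1 : TClass 1F
    T1 (inj₁ ())
    T1 (inj₂ ())

    T2 : TClass 2F
    T2 (inj₁ ())
    T2 (inj₂ ())

    cd-T : ∀ {i j} → TClass i → TClass j → i ≢ j → CD (Pair i j)
    cd-T {3F} T3 _  _ = ⊥-elim (T3 (inj₁ refl))
    cd-T {4F} T4 _  _ = ⊥-elim (T4 (inj₂ refl))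
    cd-T {_} {3F} _ T3 _ = ⊥-elim (T3 (inj₁ refl))
    cd-T {_} {4F} _ T4 _ = ⊥-elim (T4 (inj₂ refl))
    cd-T {0F} {0F} _ _ i≢j = ⊥-elim (i≢j refl)
    cd-T {0F} {1F} _ _ _   = cd01
    cd-T {0F} {2F} _ _ _   = cd02
    cd-T {1F} {0F} _ _ _   = pair-sym cd01
    cd-T {1F} {1F} _ _ i≢j = ⊥-elim (i≢j refl)
    cd-T {1F} {2F} _ _ _   = cd12
    cd-T {2F} {0F} _ _ _   = pair-sym cd02
    cd-T {2F} {1F} _ _ _   = pair-sym cd12
    cd-T {2F} {2F} _ _ i≢j = ⊥-elim (i≢j refl)

    ¬cd-T : ∀ {i} → TClass i → ¬ CD (Cl i)
    ¬cd-T {0F} _  = ¬cd0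
    ¬cd-T {1F} _  = ¬cd1
    ¬cd-T {2F} _  = ¬cd2
    ¬cd-T {3F} T3 = ⊥-elim (T3 (inj₁ refl))
    ¬cd-T {4F} T4 = ⊥-elim (T4 (inj₂ refl))

    ¬S-by-class : ∀ {i x} → Cl i x → TClass i → ¬ S x
    ¬S-by-class x∈i Ti Sx = Ti (subst SClass x∈i Sx)

    ¬S-by-pair : ∀ {i j x} → Pair i j x → TClass i → TClass j → ¬ S x
    ¬S-by-pair (inj₁ x∈i) Ti _  = ¬S-by-class x∈i Ti
    ¬S-by-pair (inj₂ x∈j) _  Tj = ¬S-by-class x∈j Tj

    S≢T : ∀ {s x} → S s → ¬ S x → s ≢ x
    S≢T Ss ¬Sx refl = ¬Sx Ss

    T-neighbours : ∀ v → ∃₂ λ x y → v ~ x × v ~ y × part x ≢ part y × ¬ S x × ¬ S y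
    T-neighbours v with neighbour-in-pair (λ ()) cd01 v
    ... | x , inj₁ x∈0 , v~x with neighbour-in-pair (λ ()) cd12 v
    ...   | y , y∈ , v~y = x , y , v~x , v~y , class-≢-pair x∈0 y∈ (λ ()) (λ ()) ,
                           ¬S-by-class x∈0 T0 , ¬S-by-pair y∈ T1 T2
    T-neighbours v | x , inj₂ x∈1 , v~x with neighbour-in-pair (λ ()) cd02 v
    ...   | y , y∈ , v~y = x , y , v~x , v~y , class-≢-pair x∈1 y∈ (λ ()) (λ ()) ,
                           ¬S-by-class x∈1 T1 , ¬S-by-pair y∈ T0 T2

    at-most-one-S-neighbour : ∀ {v s s′} → S s → S s′ → v ~ s → v ~ s′ → s ≡ s′
    at-most-one-S-neighbour {v} {s} {s′} Ss Ss′ v~s v~s′ with s ≟ s′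
    ... | yes s≡s′ = s≡s′
    ... | no  s≢s′ with T-neighbours v
    ...   | x , y , v~x , v~y , x≢y , ¬Sx , ¬Sy = ⊥-elim (no-four-neighbours maxdeg v~s v~s′ v~x v~y
              s≢s′ (S≢T Ss ¬Sx) (S≢T Ss ¬Sy) (S≢T Ss′ ¬Sx) (S≢T Ss′ ¬Sy) (x≢y ∘ cong part))

    d₀ : V
    d₀ = rep 3F

    d₀∈S : S d₀
    d₀∈S = inj₁ (rep∈ 3F)

    S-partner : ∃ λ e → S e × d₀ ~ e
    S-partner = neighbour-in-pair (λ ()) cd34 d₀

    e₀ : V
    e₀ = proj₁ S-partner

    e₀∈S : S e₀
    e₀∈S = proj₁ (proj₂ S-partner)

    d₀~e₀ : d₀ ~ e₀
    d₀~e₀ = proj₂ (proj₂ S-partner)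

    S-is-an-edge : ∀ {s} → S s → s ≡ d₀ ⊎ s ≡ e₀
    S-is-an-edge {s} Ss = follow (proj₂ cd34 d₀ s d₀∈S Ss) (inj₁ refl)
      where
      follow : ∀ {u w} → WalkIn G S u w → u ≡ d₀ ⊎ u ≡ e₀ → w ≡ d₀ ⊎ w ≡ e₀
      follow (here _)           at         = at
      follow (step _ u~z walk) (inj₁ refl) =
        follow walk (inj₂ (at-most-one-S-neighbour (walk-start walk) e₀∈S u~z d₀~e₀))
      follow (step _ u~z walk) (inj₂ refl) =
        follow walk (inj₁ (at-most-one-S-neighbour (walk-start walk) d₀∈S u~z (~-sym d₀~e₀)))

    S-side : ∀ v → v ~ d₀ ⊎ v ~ e₀
    S-side v with neighbour-in-pair (λ ()) cd34 v
    ... | s , Ss , v~s with S-is-an-edge Ss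
    ...   | inj₁ refl = inj₁ v~s
    ...   | inj₂ refl = inj₂ v~s

    Side : V → V → V → Set
    Side s x y = ∀ {w} → ¬ S w → w ~ s → w ≡ x ⊎ w ≡ y

    swap-side : ∀ {s x y} → Side s x y → Side s y x
    swap-side side ¬Sw w~s = Sum.swap (side ¬Sw w~s)

    T-neighbourhood : ∀ {s} → S s →
                      ∃₂ λ x y → x ~ s × y ~ s × part x ≢ part y × ¬ S x × ¬ S y × Side s x y
    T-neighbourhood {s} Ss with T-neighbours s | neighbour-in-pair (λ ()) cd34 s
    ... | x , y , s~x , s~y , x≢y , ¬Sx , ¬Sy | s′ , Ss′ , s~s′ =
      x , y , ~-sym s~x , ~-sym s~y , x≢y , ¬Sx , ¬Sy , only
      where
      only : Side s x y
      only {w} ¬Sw w~s with w ≟ x | w ≟ y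
      ... | yes w≡x | _       = inj₁ w≡x
      ... | no  _   | yes w≡y = inj₂ w≡y
      ... | no  w≢x | no  w≢y = ⊥-elim (no-four-neighbours maxdeg s~s′ s~x s~y (~-sym w~s)
              (S≢T Ss′ ¬Sx) (S≢T Ss′ ¬Sy) (S≢T Ss′ ¬Sw) (x≢y ∘ cong part) (w≢x ∘ sym) (w≢y ∘ sym))

    every-T-class-seen : ∀ {x₁ x₂ y₁ y₂} → Side d₀ x₁ x₂ → Side e₀ y₁ y₂ →
                         ∀ i → TClass i → i ≡ part x₁ ⊎ i ≡ part x₂ ⊎ i ≡ part y₁ ⊎ i ≡ part y₂
    every-T-class-seen d₀-side e₀-side i Ti with S-side (rep i)
    ... | inj₁ r~d₀ = Sum.map (rep-class i) (inj₁ ∘ rep-class i) (d₀-side (¬S-by-class (rep∈ i) Ti) r~d₀)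
    ... | inj₂ r~e₀ = inj₂ (inj₂ (Sum.map (rep-class i) (rep-class i) (e₀-side (¬S-by-class (rep∈ i) Ti) r~e₀)))

    module SharedClass {k₁ k₂ l m} (¬Sk₁ : ¬ S k₁) (¬Sl : ¬ S l) (¬Sm : ¬ S m)
                       (k₁~d₀ : k₁ ~ d₀) (k₂~e₀ : k₂ ~ e₀) (K≡ : part k₁ ≡ part k₂)
                       (K≢L : part k₁ ≢ part l) (K≢M : part k₁ ≢ part m) (L≢M : part l ≢ part m)
                       (d₀-side : Side d₀ k₁ l) (e₀-side : Side e₀ k₂ m) where

      ¬Sk₂ : ¬ S k₂
      ¬Sk₂ = ¬S-by-class (sym K≡) ¬Sk₁

      k₁≢k₂ : k₁ ≢ k₂
      k₁≢k₂ refl = ~-irrefl d₀~e₀ (at-most-one-S-neighbour d₀∈S e₀∈S k₁~d₀ k₂~e₀)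

      K-member : ∀ {t} → Cl (part k₁) t → t ≡ k₁ ⊎ t ≡ k₂
      K-member {t} t∈K with S-side t
      ... | inj₁ t~d₀ = Sum.map₂ (λ t≡l → ⊥-elim (K≢L (trans (sym t∈K) (cong part t≡l))))
                                 (d₀-side (¬S-by-class t∈K ¬Sk₁) t~d₀)
      ... | inj₂ t~e₀ = inj₂ (Sum.[ id , (λ t≡m → ⊥-elim (K≢M (trans (sym t∈K) (cong part t≡m)))) ]′
                                 (e₀-side (¬S-by-class t∈K ¬Sk₁) t~e₀))

      L-member : ∀ {t} → Cl (part l) t → t ≡ l
      L-member {t} t∈L with S-side t
      ... | inj₁ t~d₀ = Sum.[ (λ t≡k₁ → ⊥-elim (K≢L (trans (cong part (sym t≡k₁)) t∈L))) , id ]′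
                          (d₀-side (¬S-by-class t∈L ¬Sl) t~d₀)
      ... | inj₂ t~e₀ = [ (λ t≡k₂ → ⊥-elim (K≢L (trans K≡ (trans (cong part (sym t≡k₂)) t∈L))))
                        , (λ t≡m → ⊥-elim (L≢M (trans (sym t∈L) (cong part t≡m)))) ]
                          (e₀-side (¬S-by-class t∈L ¬Sl) t~e₀)

      M-member : ∀ {t} → Cl (part m) t → t ≡ m
      M-member {t} t∈M with S-side t
      ... | inj₁ t~d₀ = [ (λ t≡k₁ → ⊥-elim (K≢M (trans (cong part (sym t≡k₁)) t∈M)))
                        , (λ t≡l → ⊥-elim (L≢M (trans (cong part (sym t≡l)) t∈M))) ]
                          (d₀-side (¬S-by-class t∈M ¬Sm) t~d₀)
      ... | inj₂ t~e₀ = Sum.[ (λ t≡k₂ → ⊥-elim (K≢M (trans K≡ (trans (cong part (sym t≡k₂)) t∈M)))) , id ]′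
                          (e₀-side (¬S-by-class t∈M ¬Sm) t~e₀)

      K-neighbour : ∀ {x} → ¬ S x → part x ≢ part k₁ → (∀ {t} → Cl (part x) t → t ≡ x) →
                    ∃ λ u → Cl (part k₁) u × u ~ x
      K-neighbour {x} ¬Sx X≢K X-member with neighbour-in-pair (X≢K ∘ sym) (cd-T ¬Sk₁ ¬Sx (X≢K ∘ sym)) x
      ... | u , inj₁ u∈K , x~u = u , u∈K , ~-sym x~u
      ... | u , inj₂ u∈X , x~u = ⊥-elim (~-irrefl x~u (sym (X-member u∈X)))

      ¬k₁~k₂ : ¬ k₁ ~ k₂
      ¬k₁~k₂ k₁~k₂ = ¬cd-T ¬Sk₁ (dominating , connected)
        where
        dominating : Dominating G (Cl (part k₁))
        dominating v v∉K with pair? 3F 4F v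
        ... | yes Sv = [ (λ { refl → k₁ , refl , k₁~d₀ }) , (λ { refl → k₂ , sym K≡ , k₂~e₀ }) ]
                         (S-is-an-edge Sv)
        ... | no ¬Sv with S-side v
        ...   | inj₁ v~d₀ = [ (λ { refl → ⊥-elim (v∉K refl) })
                            , (λ { refl → K-neighbour ¬Sl (K≢L ∘ sym) L-member }) ]
                              (d₀-side ¬Sv v~d₀)
        ...   | inj₂ v~e₀ = [ (λ { refl → ⊥-elim (v∉K (sym K≡)) })
                            , (λ { refl → K-neighbour ¬Sm (K≢M ∘ sym) M-member }) ]
                              (e₀-side ¬Sv v~e₀)
        connected : InducedConnected G (Cl (part k₁))
        connected x y x∈K y∈K with K-member x∈K | K-member y∈K
        ... | inj₁ refl | inj₁ refl = here refl
        ... | inj₁ refl | inj₂ refl = step refl k₁~k₂ (here (sym K≡))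
        ... | inj₂ refl | inj₁ refl = step (sym K≡) (~-sym k₁~k₂) (here refl)
        ... | inj₂ refl | inj₂ refl = here (sym K≡)

      l-neighbour : ∀ {k} → Cl (part k₁) k → k ~ l
      l-neighbour {k} k∈K with neighbour-in-pair K≢L (cd-T ¬Sk₁ ¬Sl K≢L) k
      ... | u , inj₂ u∈L , k~u = subst (k ~_) (L-member u∈L) k~u
      ... | u , inj₁ u∈K , k~u with K-member u∈K | K-member k∈K
      ...   | inj₁ refl | inj₁ refl = ⊥-elim (~-irrefl k~u refl)
      ...   | inj₂ refl | inj₂ refl = ⊥-elim (~-irrefl k~u refl)
      ...   | inj₂ refl | inj₁ refl = ⊥-elim (¬k₁~k₂ k~u)
      ...   | inj₁ refl | inj₂ refl = ⊥-elim (¬k₁~k₂ (~-sym k~u))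

      l~k₁ : l ~ k₁
      l~k₁ = ~-sym (l-neighbour refl)

      l~k₂ : l ~ k₂
      l~k₂ = ~-sym (l-neighbour (sym K≡))

      l~m : l ~ m
      l~m with neighbour-in-pair L≢M (cd-T ¬Sl ¬Sm L≢M) l
      ... | u , inj₁ u∈L , l~u = ⊥-elim (~-irrefl l~u (sym (L-member u∈L)))
      ... | u , inj₂ u∈M , l~u = subst (l ~_) (M-member u∈M) l~u

      contradiction : ⊥
      contradiction with neighbour-in-pair (λ ()) cd34 l
      ... | s , Ss , l~s = no-four-neighbours maxdeg l~k₁ l~k₂ l~m l~s
        k₁≢k₂ (K≢M ∘ cong part) (S≢T Ss ¬Sk₁ ∘ sym)
              (K≢M ∘ trans K≡ ∘ cong part) (S≢T Ss ¬Sk₂ ∘ sym)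
              (S≢T Ss ¬Sm ∘ sym)

    triangle-edge-free : ⊥
    triangle-edge-free with T-neighbourhood d₀∈S | T-neighbourhood e₀∈S
    ... | x₁ , x₂ , x₁~d₀ , x₂~d₀ , x₁≢x₂ , ¬Sx₁ , ¬Sx₂ , d₀-side
        | y₁ , y₂ , y₁~e₀ , y₂~e₀ , y₁≢y₂ , ¬Sy₁ , ¬Sy₂ , e₀-side
      with classes-meet (part x₁) (part x₂) (part y₁) (part y₂) x₁≢x₂ y₁≢y₂ ¬Sx₁ ¬Sx₂ ¬Sy₁ ¬Sy₂
                        (every-T-class-seen d₀-side e₀-side)
    ... | inj₁ (x₁y₁ , x₂≢y₂) =
      SharedClass.contradiction ¬Sx₁ ¬Sx₂ ¬Sy₂ x₁~d₀ y₁~e₀ x₁y₁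
                                x₁≢x₂ (y₁≢y₂ ∘ trans (sym x₁y₁)) x₂≢y₂
                      d₀-side e₀-side
    ... | inj₂ (inj₁ (x₁y₂ , x₂≢y₁)) =
      SharedClass.contradiction ¬Sx₁ ¬Sx₂ ¬Sy₁ x₁~d₀ y₂~e₀ x₁y₂
                                x₁≢x₂ (y₁≢y₂ ∘ sym ∘ trans (sym x₁y₂)) x₂≢y₁
                      d₀-side (swap-side e₀-side)
    ... | inj₂ (inj₂ (inj₁ (x₂y₁ , x₁≢y₂))) =
      SharedClass.contradiction ¬Sx₂ ¬Sx₁ ¬Sy₂ x₂~d₀ y₁~e₀ x₂y₁
                                (x₁≢x₂ ∘ sym) (y₁≢y₂ ∘ trans (sym x₂y₁)) x₁≢y₂
                      (swap-side d₀-side) e₀-side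
    ... | inj₂ (inj₂ (inj₂ (x₂y₂ , x₁≢y₁))) =
      SharedClass.contradiction ¬Sx₂ ¬Sx₁ ¬Sy₁ x₂~d₀ y₂~e₀ x₂y₂
                                (x₁≢x₂ ∘ sym) (y₁≢y₂ ∘ sym ∘ trans (sym x₂y₂)) x₁≢y₁
                      (swap-side d₀-side) (swap-side e₀-side)

Adj : ℕ → Set
Adj n = Fin n → Fin n → Bool

UpperTriangle : ℕ → Set
UpperTriangle zero    = ⊤
UpperTriangle (suc n) = Vec Bool n × UpperTriangle n

decode : ∀ {n} → UpperTriangle n → Adj n
decode {suc n} (row , rest) zero    zero    = false
decode {suc n} (row , rest) zero    (suc j) = Vec.lookup row j
decode {suc n} (row , rest) (suc i) zero    = Vec.lookup row i
decode {suc n} (row , rest) (suc i) (suc j) = decode rest i j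

encode : ∀ {n} → Adj n → UpperTriangle n
encode {zero}  h = tt
encode {suc n} h = Vec.tabulate (h zero ∘ suc) , encode (λ i j → h (suc i) (suc j))

decode-encode : ∀ {n} (h : Adj n) → (∀ i j → h i j ≡ h j i) → (∀ i → h i i ≡ false) →
                ∀ i j → decode (encode h) i j ≡ h i j
decode-encode h h-sym h-irr zero    zero    = sym (h-irr zero)
decode-encode h h-sym h-irr zero    (suc j) = lookup∘tabulate (h zero ∘ suc) j
decode-encode h h-sym h-irr (suc i) zero    = trans (lookup∘tabulate (h zero ∘ suc) i) (h-sym zero (suc i))
decode-encode h h-sym h-irr (suc i) (suc j) =
  decode-encode (λ i j → h (suc i) (suc j)) (λ i j → h-sym (suc i) (suc j)) (h-irr ∘ suc) i j

all-Vec? : ∀ {n} {P : Vec Bool n → Set} → (∀ v → Dec (P v)) → Dec (∀ v → P v)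
all-Vec? {zero}  P? = map′ (λ { p [] → p }) (λ f → f []) (P? [])
all-Vec? {suc n} P? = map′ (λ { (t , f) (true ∷ v) → t v ; (t , f) (false ∷ v) → f v })
                           (λ g → g ∘ (true ∷_) , g ∘ (false ∷_))
                           (all-Vec? (P? ∘ (true ∷_)) ×-dec all-Vec? (P? ∘ (false ∷_)))

all-UpperTriangle? : ∀ {n} {P : UpperTriangle n → Set} → (∀ t → Dec (P t)) → Dec (∀ t → P t)
all-UpperTriangle? {zero}  P? = map′ (λ p _ → p) (λ f → f tt) (P? tt)
all-UpperTriangle? {suc n} P? = map′ (λ f (row , rest) → f row rest) (λ g row rest → g (row , rest))
                                     (all-Vec? λ row → all-UpperTriangle? λ rest → P? (row , rest))

permutations : ∀ n → List (Permutation′ n)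
permutations zero    = Perm.id ∷ []
permutations (suc n) = concatMap (λ π → map (λ j → Perm.insert zero j π) (allFin (suc n))) (permutations n)

Embeds : ∀ {n} → List (Fin n × Fin n) → Adj n → Permutation′ n → Set
Embeds edges h σ = All (λ { (i , j) → T (h (σ ⟨$⟩ʳ i) (σ ⟨$⟩ʳ j)) }) edges

embeds? : ∀ {n} edges (h : Adj n) σ → Dec (Embeds edges h σ)
embeds? edges h σ = All.all? (λ { (i , j) → T? (h (σ ⟨$⟩ʳ i) (σ ⟨$⟩ʳ j)) }) edges

IsoVia : ∀ {n} → Adj n → Adj n → Permutation′ n → Set
IsoVia h t σ = ∀ i j → h i j ≡ t (σ ⟨$⟩ʳ i) (σ ⟨$⟩ʳ j)

isoVia? : ∀ {n} (h t : Adj n) σ → Dec (IsoVia h t σ)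
isoVia? h t σ = all? λ i → all? λ j → h i j ≟ᵇ t (σ ⟨$⟩ʳ i) (σ ⟨$⟩ʳ j)

star+2 triangle+edge : List (Fin 5 × Fin 5)
star+2        = (v0 , v1) ∷ (v0 , v2) ∷ (v0 , v3) ∷ (v0 , v4) ∷ (v1 , v2) ∷ (v1 , v3) ∷ []
triangle+edge = (v0 , v1) ∷ (v0 , v2) ∷ (v1 , v2) ∷ (v3 , v4) ∷ []

targets : List (Adj 5)
targets = P2∪P3 ∷ S12 ∷ S5 ∷ P5 ∷ C3+e+e ∷ C3+2e ∷ C4+e ∷ C5 ∷ K23 ∷ []

Admissible : Adj 5 → Set
Admissible h = (∀ i → ∃ λ j → T (h i j))
             × All (¬_ ∘ Embeds star+2 h) (permutations 5)
             × All (¬_ ∘ Embeds triangle+edge h) (permutations 5)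

admissible? : ∀ h → Dec (Admissible h)
admissible? h = all? (λ i → any? (λ j → T? (h i j)))
          ×-dec All.all? (¬? ∘ embeds? star+2 h) (permutations 5)
          ×-dec All.all? (¬? ∘ embeds? triangle+edge h) (permutations 5)

degree-profile : ∀ {n} → Adj n → Fin n → ℕ
degree-profile h d = count (λ i → count (h i) ≡ᵇ toℕ d)

-- SameProfile only prunes the search: the nine targets have different degree profiles.
SameProfile : ∀ {n} → Adj n → Adj n → Set
SameProfile h t = ∀ d → degree-profile h d ≡ degree-profile t d

Classified : Adj 5 → Set
Classified h = Any (λ t → SameProfile h t × Any (IsoVia h t) (permutations 5)) targets

classified? : ∀ h → Dec (Classified h)
classified? h = Any.any? (λ t → all? (λ d → degree-profile h d ≟ℕ degree-profile t d)
                                ×-dec Any.any? (isoVia? h t) (permutations 5)) targets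

opaque
  classification : ∀ t → Admissible (decode t) → Classified (decode t)
  classification = from-yes (all-UpperTriangle? λ t → admissible? (decode t) →-dec classified? (decode t))

one-of-targets : ∀ {P : Adj 5 → Set} → Any P targets →
                 P P2∪P3 ⊎ P S12 ⊎ P S5 ⊎ P P5 ⊎ P C3+e+e ⊎ P C3+2e ⊎ P C4+e ⊎ P C5 ⊎ P K23
one-of-targets (here p)                                                 = inj₁ p
one-of-targets (there (here p))                                         = inj₂ (inj₁ p)
one-of-targets (there (there (here p)))                                 = inj₂ (inj₂ (inj₁ p))
one-of-targets (there (there (there (here p))))                         = inj₂ (inj₂ (inj₂ (inj₁ p)))
one-of-targets (there (there (there (there (here p)))))                 = inj₂ (inj₂ (inj₂ (inj₂ (inj₁ p))))
one-of-targets (there (there (there (there (there (here p))))))         = inj₂ (inj₂ (inj₂ (inj₂ (inj₂ (inj₁ p)))))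
one-of-targets (there (there (there (there (there (there (here p)))))))  = inj₂ (inj₂ (inj₂ (inj₂ (inj₂ (inj₂ (inj₁ p))))))
one-of-targets (there (there (there (there (there (there (there (here p))))))))
  = inj₂ (inj₂ (inj₂ (inj₂ (inj₂ (inj₂ (inj₂ (inj₁ p)))))))
one-of-targets (there (there (there (there (there (there (there (there (here p)))))))))
  = inj₂ (inj₂ (inj₂ (inj₂ (inj₂ (inj₂ (inj₂ (inj₂ p)))))))

module CoalitionGraph (G : Graph) (subcubic : Subcubic G) (part : Fin (n G) → Fin 5) (ccp : IsCCPartition G part) where

  open GraphLemmas G

  maxdeg : ∀ v → degree G v ≤ 3
  maxdeg = proj₂ subcubic

  nonempty : ∀ i → ∃ λ v → part v ≡ i
  nonempty = proj₁ ccp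

  open Classes G part nonempty

  H : Fin 5 → Fin 5 → Set
  H = CCGAdj G part

  opaque
    h : Adj 5
    h i j = ⌊ coalition? i j ⌋

    T-h⇒H : ∀ {i j} → T (h i j) → H i j
    T-h⇒H = toWitness

    H⇒T-h : ∀ {i j} → H i j → T (h i j)
    H⇒T-h = fromWitness

  -- h in the encoded form that the exhaustive classification is stated for
  h′ : Adj 5
  h′ = decode (encode h)

  h′≡h : ∀ i j → h′ i j ≡ h i j
  h′≡h = decode-encode h (λ i j → T-ext (H⇒T-h ∘ coalition-sym ∘ T-h⇒H) (H⇒T-h ∘ coalition-sym ∘ T-h⇒H))
                         (λ i → T-ext (⊥-elim ∘ coalition-irrefl ∘ T-h⇒H) (λ ()))

  T⇒H : ∀ {i j} → T (h′ i j) → H i j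
  T⇒H {i} {j} = T-h⇒H ∘ subst T (h′≡h i j)

  H⇒T : ∀ {i j} → H i j → T (h′ i j)
  H⇒T {i} {j} = subst T (sym (h′≡h i j)) ∘ H⇒T-h

  no-isolated : ∀ i → ∃ λ j → T (h′ i j)
  no-isolated i with proj₂ ccp i
  ... | inj₁ ((dominating , _) , v , single) =
        ⊥-elim (<⇒≱ (s≤s (s≤s (maxdeg v))) (singleton-dominating⇒k≤suc-degree dominating single))
  ... | inj₂ (j , coalition) = j , H⇒T coalition

  -- StarFree and TriangleEdgeFree are stated for the labels 0F … 4F; relabelling the
  -- classes by σ⁻¹ moves an occurrence of a configuration at σ onto these labels.
  module Relabelled (σ : Permutation′ 5) where

    part′ : Fin (n G) → Fin 5
    part′ = (σ ⟨$⟩ˡ_) ∘ part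

    nonempty′ : ∀ i → ∃ λ v → part′ v ≡ i
    nonempty′ i = rep (σ ⟨$⟩ʳ i) , relabel-class {G} part σ (rep∈ (σ ⟨$⟩ʳ i))

    coalition′ : ∀ {a b} → T (h′ (σ ⟨$⟩ʳ a) (σ ⟨$⟩ʳ b)) → CCGAdj G part′ a b
    coalition′ = relabel-coalition σ ∘ T⇒H

    cd′ : ∀ {a b} → T (h′ (σ ⟨$⟩ʳ a) (σ ⟨$⟩ʳ b)) →
          ConnDominating G (_∪_ {G} (Class G part′ a) (Class G part′ b))
    cd′ = coalition-CD ∘ coalition′

    no-star+2 : ¬ Embeds star+2 h′ σ
    no-star+2 (e01 ∷ e02 ∷ e03 ∷ e04 ∷ e12 ∷ e13 ∷ []) =
      StarFree.star-free G maxdeg part′ nonempty′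
        (cd′ e01) (cd′ e02) (cd′ e03) (cd′ e04) (cd′ e12) (cd′ e13) (coalition-¬CDˡ (coalition′ e01))

    no-triangle+edge : ¬ Embeds triangle+edge h′ σ
    no-triangle+edge (e01 ∷ e02 ∷ e12 ∷ e34 ∷ []) =
      TriangleEdgeFree.triangle-edge-free G maxdeg part′ nonempty′
        (cd′ e01) (cd′ e02) (cd′ e12) (cd′ e34)
        (coalition-¬CDˡ (coalition′ e01)) (coalition-¬CDˡ (coalition′ e12)) (coalition-¬CDʳ (coalition′ e02))

  admissible : Admissible h′
  admissible = no-isolated ,
               All.tabulate (λ {σ} _ → Relabelled.no-star+2 σ) ,
               All.tabulate (λ {σ} _ → Relabelled.no-triangle+edge σ)

  iso : ∀ {t} → ∃ (IsoVia h′ t) → IsoTo H t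
  iso (σ , h′≡t) = σ , λ i j → mk⇔ (subst T (h′≡t i j) ∘ H⇒T) (T⇒H ∘ subst T (sym (h′≡t i j)))

lemma8 : (G : Graph) → Subcubic G → (part : Fin (n G) → Fin 5) → IsCCPartition G part →
    let H = CCGAdj G part in
    IsoTo H P2∪P3 ⊎ IsoTo H S12 ⊎ IsoTo H S5 ⊎ IsoTo H P5 ⊎ IsoTo H C3+e+e
      ⊎ IsoTo H C3+2e ⊎ IsoTo H C4+e ⊎ IsoTo H C5 ⊎ IsoTo H K23
lemma8 G subcubic part ccp =
  one-of-targets {IsoTo H} (Any.map (λ {t} → iso {t} ∘ Any.satisfied ∘ proj₂) (classification (encode h) admissible))
  where open CoalitionGraph G subcubic part ccp
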